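{- For every matroid $M$ of rank $r$, $$[t]\,Q_M(t) = |w_{1,r}| - |w_{0,r-1}|,$$ where $[t]p(t)$ denotes the coefficient of $t$ in a polynomial $p(t)$.
   Context: For a matroid $M$ of rank $r$ with ground set $E$, let $\mathscr{L}(M)$ be its lattice of flats ordered by inclusion, with minimum $\hat 0$ (the closure of the empty set) and maximum $E$, rank function $\operatorname{rk}$ and Möbius function $\mu$ (with $\mu(F,G)=0$ unless $F\le G$). The characteristic polynomial is $\chi_M(t)=\sum_{F\in\mathscr{L}(M)}\mu(\hat 0,F)\,t^{r-\operatorname{rk}F}$. For a flat $F$, $M_F$ is the restriction of $M$ to $F$ (lattice of flats $[\hat 0,F]$, rank $\operatorname{rk}F$) and $M^F$ is the contraction $M/F$ (lattice of flats $[F,E]$, rank $r-\operatorname{rk}F$); all quantities depend only on the lattice of flats. The Kazhdan–Lusztig polynomial $P_M(t)$ and inverse Kazhdan–Lusztig polynomial $Q_M(t)$ are the unique assignment of polynomials in $\mathbb{Z}[t]$ to every matroid such that: if $r=0$ then $P_M=Q_M=1$; if $r>0$ then $\deg P_M<r/2$ and $\deg Q_M<r/2$; and for every $M$, $t^rP_M(t^{ -1})=\sum_{F\in\mathscr{L}(M)}\chi_{M_F}(t)P_{M^F}(t)$ and $(-1)^r t^rQ_M(t^{ -1})=\sum_{F\in\mathscr{L}(M)}(-1)^{\operatorname{rk}F}Q_{M_F}(t)\,t^{r-\operatorname{rk}F}\chi_{M^F}(t^{ -1})$. The doubly-indexed Whitney numbers of the first kind are $w_{i,j}=\sum_{\operatorname{rk}F=i,\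 \operatorname{rk}G=j}\mu(F,G)$, the sum over pairs of flats of ranks $i$ and $j$. -}

module Defs where

open import Data.Nat as ℕ using (ℕ; zero; suc; _≤_; _∸_; _≡ᵇ_; _≤ᵇ_)
open import Data.Integer as ℤ using (ℤ; +_; 0ℤ; 1ℤ; -_; _*_; _+_)
open import Data.Bool using (Bool; true; false; if_then_else_; not; _∧_)
import Data.Bool.Properties as BoolP
open import Data.Fin using (Fin)
open import Data.Fin.Subset using (Subset; _⊆_; _∪_; _∩_; ∣_∣; ⁅_⁆; ⊤; ⊥; inside; outside)
open import Data.Fin.Subset.Properties using (_⊆?_)
open import Data.Vec using (Vec; []; _∷_; lookup)
open import Data.Vec.Properties using (≡-dec)
open import Data.List using (List; []; _∷_; map; _++_; foldr; allFin; upTo; filter)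
open import Relation.Nullary using (does)
open import Relation.Binary.PropositionalEquality using (_≡_)
open import Data.Product using (_×_)
import Data.Bool
import Data.Vec

record Matroid (n : ℕ) : Set where
  field
    rank       : Subset n → ℕ
    rank-≤     : ∀ X → rank X ≤ ∣ X ∣
    rank-mono  : ∀ X Y → X ⊆ Y → rank X ≤ rank Y
    rank-submod : ∀ X Y → rank (X ∪ Y) ℕ.+ rank (X ∩ Y) ≤ rank X ℕ.+ rank Y

Poly : Set
Poly = ℕ → ℤ

Σ[_]_ : ∀ {A : Set} → List A → (A → ℤ) → ℤ
Σ[ xs ] f = foldr (λ x acc → f x + acc) 0ℤ xs

_*ₚ_ : Poly → Poly → Poly
(p *ₚ q) k = Σ[ upTo (suc k) ] (λ i → p i * q (k ∸ i))

-- reversal: (rev d p)(t) = t^d p(t⁻¹)  (a polynomial when deg p ≤ d)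
rev : ℕ → Poly → Poly
rev d p k = if k ≤ᵇ d then p (d ∸ k) else 0ℤ

_·ₚ_ : ℤ → Poly → Poly
(c ·ₚ p) k = c * p k

sgn : ℕ → ℤ
sgn zero = 1ℤ
sgn (suc k) = - sgn k

allSubsets : (n : ℕ) → List (Subset n)
allSubsets zero = [] ∷ []
allSubsets (suc n) = map (outside ∷_) (allSubsets n) ++ map (inside ∷_) (allSubsets n)

_⊆ᵇ_ : ∀ {n} → Subset n → Subset n → Bool
X ⊆ᵇ Y = does (X ⊆? Y)

_==ᵇ_ : ∀ {n} → Subset n → Subset n → Bool
X ==ᵇ Y = does (≡-dec BoolP._≟_ X Y)

module _ {n : ℕ} (M : Matroid n) where
  open Matroid M

  isFlat : Subset n → Bool
  isFlat F = foldr _∧_ true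
    (map (λ e → if lookup F e then true else not (rank (F ∪ ⁅ e ⁆) ≡ᵇ rank F)) (allFin n))

  flats : List (Subset n)
  flats = filter (λ F → isFlat F Data.Bool.≟ true) (allSubsets n)

  closure : Subset n → Subset n
  closure X = Data.Vec.tabulate (λ e → if lookup X e then true else (rank (X ∪ ⁅ e ⁆) ≡ᵇ rank X))

  0̂ : Subset n
  0̂ = closure ⊥

  r : ℕ
  r = rank ⊤

  interval : Subset n → Subset n → List (Subset n)
  interval F G = filter (λ H → (F ⊆ᵇ H ∧ H ⊆ᵇ G) Data.Bool.≟ true) flats

  -- Möbius function of the lattice of flats, by the standard recursion
  -- μ(F,F) = 1, μ(F,G) = - Σ_{F ≤ H < G} μ(F,H), μ(F,G) = 0 unless F ≤ G.
  -- (fuel-indexed; fuel n+1 exceeds the length of any chain of flats)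
  mob : ℕ → Subset n → Subset n → ℤ
  mob zero F G = 0ℤ
  mob (suc k) F G =
    if F ⊆ᵇ G
    then (if F ==ᵇ G then 1ℤ
          else - (Σ[ filter (λ H → not (H ==ᵇ G) Data.Bool.≟ true) (interval F G) ] (λ H → mob k F H)))
    else 0ℤ

  μ : Subset n → Subset n → ℤ
  μ = mob (suc n)

  -- characteristic polynomial of the minor with lattice of flats [F,G]
  -- (rank rk G - rk F):  χ(t) = Σ_{H ∈ [F,G]} μ(F,H) t^{rk G - rk H}
  χ : Subset n → Subset n → Poly
  χ F G k = Σ[ interval F G ] (λ H → if (rank G ∸ rank H) ≡ᵇ k then μ F H else 0ℤ)

  -- doubly-indexed Whitney numbers of the first kind (indices in ℤ, so that
  -- w_{i,j} = 0 when i or j is negative)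
  w : ℤ → ℤ → ℤ
  w i j = Σ[ flats ] (λ F → Σ[ flats ] (λ G →
            if does (+ rank F ℤ.≟ i) ∧ does (+ rank G ℤ.≟ j) then μ F G else 0ℤ))

  -- q is an inverse Kazhdan–Lusztig assignment on all intervals [F,G] of
  -- the lattice of flats of M (i.e. on all minors M^F_G, whose lattice of
  -- flats is [F,G]); restriction of [F,G] to H is [F,H], contraction is [H,G].
  record IsInverseKL (q : Subset n → Subset n → Poly) : Set where
    field
      rank-zero : ∀ F G → isFlat F ≡ true → isFlat G ≡ true → F ⊆ G →
                  rank G ≡ rank F → q F G 0 ≡ 1ℤ × (∀ k → q F G (suc k) ≡ 0ℤ)
      degree    : ∀ F G → isFlat F ≡ true → isFlat G ≡ true → F ⊆ G →
                  ℕ.suc (rank F) ≤ rank G →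
                  ∀ k → rank G ∸ rank F ≤ 2 ℕ.* k → q F G k ≡ 0ℤ
      recursion : ∀ F G → isFlat F ≡ true → isFlat G ≡ true → F ⊆ G → ∀ k →
                  (sgn (rank G ∸ rank F) ·ₚ rev (rank G ∸ rank F) (q F G)) k
                  ≡ Σ[ interval F G ] (λ H →
                      (sgn (rank H ∸ rank F) ·ₚ (q F H *ₚ rev (rank G ∸ rank H) (χ H G))) k)

-- Compare the coefficients of t^(r-1) in the recursion defining Q_M.  Since deg Q_{M_F} < rk F / 2, only the
-- flats of rank 0 and 1 contribute, and Q_{M_F} = 1 for them; this gives (-1)^r [t] Q_M = w_{0,r-1} - w_{1,r}.
-- By Weisner's theorem μ(F,G) has sign (-1)^(rk G - rk F), so (-1)^(r-1) w_{0,r-1} = |w_{0,r-1}| and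
-- (-1)^(r-1) w_{1,r} = |w_{1,r}|.

{-# OPTIONS --safe #-}
module Submission where

open import Defs
open import Data.Nat as ℕ using (ℕ; zero; suc; _≤_; _<_; _∸_; _≡ᵇ_; z≤n; s≤s)
import Data.Nat.Properties as ℕP
open import Data.Integer as ℤ using (ℤ; +_; 0ℤ; 1ℤ; -_; _*_; _+_; _-_; ∣_∣)
import Data.Integer.Properties as ℤP
open import Data.Integer.Tactic.RingSolver using (solve-∀)
open import Algebra.Bundles using (AbelianGroup)
open import Algebra.Properties.Group (AbelianGroup.group ℤP.+-0-abelianGroup) using (inverseˡ-unique)
open import Data.Bool using (Bool; true; false; if_then_else_; not; _∧_)
import Data.Bool.Properties as BoolP
open import Data.List using (List; []; _∷_; map; _++_; foldr; filter; allFin; applyUpTo)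
open import Data.List.Relation.Unary.All using (All; []; _∷_)
import Data.List.Relation.Unary.All as All
import Data.List.Relation.Unary.All.Properties as AllP
open import Data.List.Relation.Unary.Any using (here; there)
open import Data.List.Membership.Propositional using () renaming (_∈_ to _∈ₗ_)
open import Data.List.Membership.Propositional.Properties using (∈-allFin; ∈-filter⁺)
open import Data.Fin using (Fin)
open import Data.Fin.Subset using (Subset; _⊆_; _∪_; _∩_; ⁅_⁆; ⊤; ⊥; _∈_; inside; outside)
open import Data.Fin.Subset.Properties
open import Data.Fin.Properties using (¬∀⟶∃¬)
open import Data.Vec using ([]; _∷_; lookup)
open import Data.Vec.Properties using (≡-dec; ∷-injective; lookup∘tabulate; []=⇒lookup; lookup⇒[]=)
open import Data.Product using (_×_; _,_; proj₁; proj₂; Σ; ∃)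
open import Data.Sum using (inj₁; inj₂)
open import Data.Empty using (⊥-elim)
open import Relation.Nullary using (Dec; yes; no; does; ¬_)
open import Relation.Nullary.Decidable using (dec-true; dec-false; decidable-stable; _→-dec_)
open import Relation.Binary.PropositionalEquality

from-does : ∀ {A : Set} (a? : Dec A) → does a? ≡ true → A
from-does (yes a) _ = a

does-≟-true : ∀ b → does (b Data.Bool.≟ true) ≡ b
does-≟-true true = refl
does-≟-true false = refl

true⇔true⇒≡ : ∀ {a b : Bool} → (a ≡ true → b ≡ true) → (b ≡ true → a ≡ true) → a ≡ b
true⇔true⇒≡ {true} {true} _ _ = refl
true⇔true⇒≡ {true} {false} f _ = sym (f refl)
true⇔true⇒≡ {false} {true} _ g = g refl
true⇔true⇒≡ {false} {false} _ _ = refl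

false≢true : false ≢ true
false≢true ()

∧-intro : ∀ {a b} → a ≡ true → b ≡ true → a ∧ b ≡ true
∧-intro refl refl = refl

⟦_⟧_ : Bool → ℤ → ℤ
⟦ b ⟧ v = if b then v else 0ℤ

module _ {A : Set} where

  Σ-cong : ∀ (xs : List A) {f g : A → ℤ} → (∀ x → f x ≡ g x) → Σ[ xs ] f ≡ Σ[ xs ] g
  Σ-cong [] eq = refl
  Σ-cong (x ∷ xs) eq = cong₂ _+_ (eq x) (Σ-cong xs eq)

  Σ-zero : ∀ (xs : List A) {f : A → ℤ} → (∀ x → f x ≡ 0ℤ) → Σ[ xs ] f ≡ 0ℤ
  Σ-zero [] eq = refl
  Σ-zero (x ∷ xs) eq = cong₂ _+_ (eq x) (Σ-zero xs eq)

  Σ-+ : ∀ (xs : List A) (f g : A → ℤ) → Σ[ xs ] (λ x → f x + g x) ≡ Σ[ xs ] f + Σ[ xs ] g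
  Σ-+ [] f g = refl
  Σ-+ (x ∷ xs) f g rewrite Σ-+ xs f g = lem (f x) (g x) (Σ[ xs ] f) (Σ[ xs ] g)
    where lem : ∀ a b c d → (a + b) + (c + d) ≡ (a + c) + (b + d)
          lem = solve-∀

  Σ-*ˡ : ∀ (xs : List A) (c : ℤ) (f : A → ℤ) → Σ[ xs ] (λ x → c * f x) ≡ c * Σ[ xs ] f
  Σ-*ˡ [] c f = sym (ℤP.*-zeroʳ c)
  Σ-*ˡ (x ∷ xs) c f rewrite Σ-*ˡ xs c f = sym (ℤP.*-distribˡ-+ c (f x) (Σ[ xs ] f))

  Σ-neg : ∀ (xs : List A) (f : A → ℤ) → Σ[ xs ] (λ x → - f x) ≡ - Σ[ xs ] f
  Σ-neg [] f = refl
  Σ-neg (x ∷ xs) f rewrite Σ-neg xs f = sym (ℤP.neg-distrib-+ (f x) (Σ[ xs ] f))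

  Σ-++ : ∀ (xs ys : List A) (f : A → ℤ) → Σ[ xs ++ ys ] f ≡ Σ[ xs ] f + Σ[ ys ] f
  Σ-++ [] ys f = sym (ℤP.+-identityˡ _)
  Σ-++ (x ∷ xs) ys f rewrite Σ-++ xs ys f = sym (ℤP.+-assoc (f x) _ _)

  Σ-filter : ∀ {P : A → Set} (P? : ∀ x → Dec (P x)) (xs : List A) (f : A → ℤ) →
             Σ[ filter P? xs ] f ≡ Σ[ xs ] (λ x → ⟦ does (P? x) ⟧ f x)
  Σ-filter P? [] f = refl
  Σ-filter P? (x ∷ xs) f with does (P? x)
  ... | true = cong (λ s → f x + s) (Σ-filter P? xs f)
  ... | false = trans (Σ-filter P? xs f) (sym (ℤP.+-identityˡ _))

  Σ-nonneg : ∀ (xs : List A) (f : A → ℤ) → (∀ x → 0ℤ ℤ.≤ f x) → 0ℤ ℤ.≤ Σ[ xs ] f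
  Σ-nonneg [] f h = ℤP.≤-refl
  Σ-nonneg (x ∷ xs) f h = ℤP.+-mono-≤ (h x) (Σ-nonneg xs f h)

  ⟦⟧-Σ : ∀ (xs : List A) b (f : A → ℤ) → ⟦ b ⟧ (Σ[ xs ] f) ≡ Σ[ xs ] (λ x → ⟦ b ⟧ f x)
  ⟦⟧-Σ xs true f = refl
  ⟦⟧-Σ xs false f = sym (Σ-zero xs (λ _ → refl))

Σ-map : ∀ {A B : Set} (g : A → B) (xs : List A) (f : B → ℤ) → Σ[ map g xs ] f ≡ Σ[ xs ] (λ x → f (g x))
Σ-map g [] f = refl
Σ-map g (x ∷ xs) f = cong (λ s → f (g x) + s) (Σ-map g xs f)

Σ-comm : ∀ {A B : Set} (xs : List A) (ys : List B) (f : A → B → ℤ) →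
         Σ[ xs ] (λ x → Σ[ ys ] (f x)) ≡ Σ[ ys ] (λ y → Σ[ xs ] (λ x → f x y))
Σ-comm [] ys f = sym (Σ-zero ys (λ _ → refl))
Σ-comm (x ∷ xs) ys f rewrite Σ-comm xs ys f = sym (Σ-+ ys (f x) (λ y → Σ[ xs ] (λ x → f x y)))

⟦⟧-true : ∀ {b} v → b ≡ true → ⟦ b ⟧ v ≡ v
⟦⟧-true v refl = refl

⟦⟧-cong : ∀ b {u v} → (b ≡ true → u ≡ v) → ⟦ b ⟧ u ≡ ⟦ b ⟧ v
⟦⟧-cong true u≡v = u≡v refl
⟦⟧-cong false _ = refl

⟦⟧-0 : ∀ b → ⟦ b ⟧ 0ℤ ≡ 0ℤ
⟦⟧-0 true = refl
⟦⟧-0 false = refl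

⟦⟧-∧ : ∀ a b v → ⟦ a ⟧ ⟦ b ⟧ v ≡ ⟦ a ∧ b ⟧ v
⟦⟧-∧ true b v = refl
⟦⟧-∧ false b v = refl

⟦⟧-neg : ∀ b v → ⟦ b ⟧ (- v) ≡ - ⟦ b ⟧ v
⟦⟧-neg true v = refl
⟦⟧-neg false v = refl

⟦⟧-+ : ∀ b u v → ⟦ b ⟧ (u + v) ≡ ⟦ b ⟧ u + ⟦ b ⟧ v
⟦⟧-+ true u v = refl
⟦⟧-+ false u v = refl

Σ-applyUpTo-zero : ∀ (f : ℕ → ℕ) m (h : ℕ → ℤ) → (∀ i → i < m → h (f i) ≡ 0ℤ) → Σ[ applyUpTo f m ] h ≡ 0ℤ
Σ-applyUpTo-zero f zero h _ = refl
Σ-applyUpTo-zero f (suc m) h hf =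
  cong₂ _+_ (hf 0 (s≤s z≤n)) (Σ-applyUpTo-zero (λ i → f (suc i)) m h (λ i i<m → hf (suc i) (s≤s i<m)))

*ₚ-constantˡ : ∀ (q p : Poly) k c → q 0 ≡ c → (∀ i → q (suc i) ≡ 0ℤ) → (q *ₚ p) k ≡ c * p k
*ₚ-constantˡ q p k c q0 q+ = begin
    q 0 * p k + Σ[ applyUpTo suc k ] (λ i → q i * p (k ∸ i))
  ≡⟨ cong₂ _+_ (cong (_* p k) q0) (Σ-applyUpTo-zero suc k (λ i → q i * p (k ∸ i)) (λ i _ → cong (_* p (k ∸ suc i)) (q+ i))) ⟩
    c * p k + 0ℤ
  ≡⟨ ℤP.+-identityʳ _ ⟩
    c * p k ∎
  where open ≡-Reasoning

*ₚ-coeff-zero : ∀ (q p : Poly) k → (∀ i → i ≤ k → q i * p (k ∸ i) ≡ 0ℤ) → (q *ₚ p) k ≡ 0ℤ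
*ₚ-coeff-zero q p k h = Σ-applyUpTo-zero (λ i → i) (suc k) (λ i → q i * p (k ∸ i)) (λ i i<1+k → h i (ℕP.≤-pred i<1+k))

rev-k-k : ∀ (p : Poly) k → rev k p k ≡ p 0
rev-k-k p k rewrite dec-true (k ℕP.≤? k) ℕP.≤-refl = cong p (ℕP.n∸n≡0 k)

rev-1+k-k : ∀ (p : Poly) k → rev (suc k) p k ≡ p 1
rev-1+k-k p k rewrite dec-true (k ℕP.≤? suc k) (ℕP.n≤1+n k) = cong p (ℕP.m+n∸n≡m 1 k)

rev-vanishes : ∀ d (p : Poly) k → d < k → rev d p k ≡ 0ℤ
rev-vanishes d p k d<k rewrite dec-false (k ℕP.≤? d) (ℕP.<⇒≱ d<k) = refl

sgn*sgn≡1 : ∀ k → sgn k * sgn k ≡ 1ℤ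
sgn*sgn≡1 zero = refl
sgn*sgn≡1 (suc k) = trans (neg*neg (sgn k)) (sgn*sgn≡1 k)
  where neg*neg : ∀ a → (- a) * (- a) ≡ a * a
        neg*neg = solve-∀

∣sgn*x∣≡∣x∣ : ∀ k x → ∣ sgn k * x ∣ ≡ ∣ x ∣
∣sgn*x∣≡∣x∣ zero x = cong ∣_∣ (ℤP.*-identityˡ x)
∣sgn*x∣≡∣x∣ (suc k) x = begin
  ∣ - sgn k * x ∣   ≡⟨ cong ∣_∣ (sym (ℤP.neg-distribˡ-* (sgn k) x)) ⟩
  ∣ - (sgn k * x) ∣ ≡⟨ ℤP.∣-i∣≡∣i∣ (sgn k * x) ⟩
  ∣ sgn k * x ∣     ≡⟨ ∣sgn*x∣≡∣x∣ k x ⟩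
  ∣ x ∣             ∎
  where open ≡-Reasoning

0≤sgn*x⇒+∣x∣≡sgn*x : ∀ k x → 0ℤ ℤ.≤ sgn k * x → + ∣ x ∣ ≡ sgn k * x
0≤sgn*x⇒+∣x∣≡sgn*x k x 0≤sx = trans (cong +_ (sym (∣sgn*x∣≡∣x∣ k x))) (ℤP.0≤i⇒+∣i∣≡i 0≤sx)

_≟ₛ_ : ∀ {n} (X Y : Subset n) → Dec (X ≡ Y)
X ≟ₛ Y = ≡-dec BoolP._≟_ X Y

not-==ᵇ⇒≢ : ∀ {n} {X Y : Subset n} → not (X ==ᵇ Y) ≡ true → X ≢ Y
not-==ᵇ⇒≢ {X = X} {Y} X≠Y X≡Y = false≢true (trans (cong not (sym (dec-true (X ≟ₛ Y) X≡Y))) X≠Y)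

Σₛ : ∀ {n} → (Subset n → ℤ) → ℤ
Σₛ {n} f = Σ[ allSubsets n ] f

Σₛ-point : ∀ {n} (f : Subset n → ℤ) (c : Subset n) → (∀ X → X ≢ c → f X ≡ 0ℤ) → Σₛ f ≡ f c
Σₛ-point {zero} f [] _ = ℤP.+-identityʳ _
Σₛ-point {suc n} f (b ∷ c) f0 = begin
    Σ[ map (outside ∷_) (allSubsets n) ++ map (inside ∷_) (allSubsets n) ] f
  ≡⟨ Σ-++ (map (outside ∷_) (allSubsets n)) _ f ⟩
    Σ[ map (outside ∷_) (allSubsets n) ] f + Σ[ map (inside ∷_) (allSubsets n) ] f
  ≡⟨ cong₂ _+_ (Σ-map (outside ∷_) (allSubsets n) f) (Σ-map (inside ∷_) (allSubsets n) f) ⟩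
    Σₛ (λ X → f (outside ∷ X)) + Σₛ (λ X → f (inside ∷ X))
  ≡⟨ by-head b f0 ⟩
    f (b ∷ c) ∎
  where
    open ≡-Reasoning
    tail≢ : ∀ {b' b X} → X ≢ c → b' ∷ X ≢ b ∷ c
    tail≢ X≢c eq = X≢c (proj₂ (∷-injective eq))
    by-head : ∀ b → (∀ X → X ≢ b ∷ c → f X ≡ 0ℤ) →
              Σₛ (λ X → f (outside ∷ X)) + Σₛ (λ X → f (inside ∷ X)) ≡ f (b ∷ c)
    by-head false f0 = trans
      (cong₂ _+_ (Σₛ-point _ c (λ X X≢c → f0 _ (tail≢ X≢c))) (Σ-zero (allSubsets n) (λ X → f0 _ (λ ()))))
      (ℤP.+-identityʳ _)
    by-head true f0 = trans
      (cong₂ _+_ (Σ-zero (allSubsets n) (λ X → f0 _ (λ ()))) (Σₛ-point _ c (λ X X≢c → f0 _ (tail≢ X≢c))))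
      (ℤP.+-identityˡ _)

Σₛ-⟦⟧-cong : ∀ {n} (b : Subset n → Bool) (f g : Subset n → ℤ) → (∀ X → b X ≡ true → f X ≡ g X) →
             Σₛ (λ X → ⟦ b X ⟧ f X) ≡ Σₛ (λ X → ⟦ b X ⟧ g X)
Σₛ-⟦⟧-cong {n} b f g f≡g = Σ-cong (allSubsets n) (λ X → ⟦⟧-cong (b X) (f≡g X))

Σₛ-⟦⟧-zero : ∀ {n} (b : Subset n → Bool) (f : Subset n → ℤ) → (∀ X → b X ≡ true → f X ≡ 0ℤ) →
             Σₛ (λ X → ⟦ b X ⟧ f X) ≡ 0ℤ
Σₛ-⟦⟧-zero {n} b f f0 = trans (Σₛ-⟦⟧-cong b f (λ _ → 0ℤ) f0) (Σ-zero (allSubsets n) (λ X → ⟦⟧-0 (b X)))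

Σₛ-⟦⟧-point : ∀ {n} (b : Subset n → Bool) (f : Subset n → ℤ) (c : Subset n) →
              (∀ X → b X ≡ true → X ≡ c) → Σₛ (λ X → ⟦ b X ⟧ f X) ≡ ⟦ b c ⟧ f c
Σₛ-⟦⟧-point b f c unique = Σₛ-point _ c off-c
  where
    off-c : ∀ X → X ≢ c → ⟦ b X ⟧ f X ≡ 0ℤ
    off-c X X≢c with b X in bX
    ... | true = ⊥-elim (X≢c (unique X bX))
    ... | false = refl

Σₛ-split : ∀ {n} (c : Subset n) (f : Subset n → ℤ) → Σₛ f ≡ f c + Σₛ (λ X → ⟦ not (X ==ᵇ c) ⟧ f X)
Σₛ-split {n} c f = begin
    Σₛ f
  ≡⟨ Σ-cong (allSubsets n) (λ X → split (X ==ᵇ c) (f X)) ⟩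
    Σₛ (λ X → ⟦ X ==ᵇ c ⟧ f X + ⟦ not (X ==ᵇ c) ⟧ f X)
  ≡⟨ Σ-+ (allSubsets n) (λ X → ⟦ X ==ᵇ c ⟧ f X) (λ X → ⟦ not (X ==ᵇ c) ⟧ f X) ⟩
    Σₛ (λ X → ⟦ X ==ᵇ c ⟧ f X) + Σₛ (λ X → ⟦ not (X ==ᵇ c) ⟧ f X)
  ≡⟨ cong (_+ Σₛ (λ X → ⟦ not (X ==ᵇ c) ⟧ f X)) at-c ⟩
    f c + Σₛ (λ X → ⟦ not (X ==ᵇ c) ⟧ f X) ∎
  where
    open ≡-Reasoning
    split : ∀ b v → v ≡ ⟦ b ⟧ v + ⟦ not b ⟧ v
    split true v = sym (ℤP.+-identityʳ v)
    split false v = sym (ℤP.+-identityˡ v)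
    at-c : Σₛ (λ X → ⟦ X ==ᵇ c ⟧ f X) ≡ f c
    at-c = trans (Σₛ-⟦⟧-point (_==ᵇ c) f c (λ X → from-does (X ≟ₛ c)))
                 (⟦⟧-true (f c) (dec-true (c ≟ₛ c) refl))

∪-lub : ∀ {n} {X Y Z : Subset n} → X ⊆ Z → Y ⊆ Z → X ∪ Y ⊆ Z
∪-lub {X = X} {Y} X⊆Z Y⊆Z x∈ with x∈p∪q⁻ X Y x∈
... | inj₁ x∈X = X⊆Z x∈X
... | inj₂ x∈Y = Y⊆Z x∈Y

∩-glb : ∀ {n} {X Y Z : Subset n} → Z ⊆ X → Z ⊆ Y → Z ⊆ X ∩ Y
∩-glb Z⊆X Z⊆Y x∈ = x∈p∩q⁺ (Z⊆X x∈ , Z⊆Y x∈)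

⁅x⁆⊆p : ∀ {n} {x : Fin n} {X : Subset n} → x ∈ X → ⁅ x ⁆ ⊆ X
⁅x⁆⊆p {x = x} x∈X y∈ = subst (_∈ _) (sym (x∈⁅y⁆⇒x≡y x y∈)) x∈X

module MatroidProperties {n : ℕ} (M : Matroid n) where
  open Matroid M

  Flat : Subset n → Set
  Flat F = isFlat M F ≡ true

  _spans_ : Subset n → Fin n → Set
  X spans e = rank (X ∪ ⁅ e ⁆) ≡ rank X

  rank-⊆ : ∀ {X Y} → X ⊆ Y → rank X ≤ rank Y
  rank-⊆ = rank-mono _ _

  rank≤rank⊤ : ∀ X → rank X ≤ rank ⊤
  rank≤rank⊤ X = rank-⊆ ⊆⊤

  rank-⊥ : rank ⊥ ≡ 0
  rank-⊥ = ℕP.n≤0⇒n≡0 (subst (rank ⊥ ≤_) (∣⊥∣≡0 n) (rank-≤ ⊥))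

  ∈⇒spans : ∀ {X e} → e ∈ X → X spans e
  ∈⇒spans e∈X = ℕP.≤-antisym (rank-⊆ (∪-lub ⊆-refl (⁅x⁆⊆p e∈X))) (rank-⊆ (p⊆p∪q _))

  spans-mono : ∀ {X Y e} → X ⊆ Y → X spans e → Y spans e
  spans-mono {X} {Y} {e} X⊆Y X-spans = ℕP.≤-antisym (ℕP.+-cancelʳ-≤ (rank X) _ _ submod) (rank-⊆ (p⊆p∪q _))
    where
      open ℕP.≤-Reasoning
      submod : rank (Y ∪ ⁅ e ⁆) ℕ.+ rank X ≤ rank Y ℕ.+ rank X
      submod = begin
        rank (Y ∪ ⁅ e ⁆) ℕ.+ rank X
          ≤⟨ ℕP.+-mono-≤ (rank-⊆ (∪-lub (p⊆p∪q _) (λ x∈ → q⊆p∪q Y _ (q⊆p∪q X _ x∈))))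
                         (rank-⊆ (∩-glb X⊆Y (p⊆p∪q _))) ⟩
        rank (Y ∪ (X ∪ ⁅ e ⁆)) ℕ.+ rank (Y ∩ (X ∪ ⁅ e ⁆))
          ≤⟨ rank-submod Y (X ∪ ⁅ e ⁆) ⟩
        rank Y ℕ.+ rank (X ∪ ⁅ e ⁆)
          ≡⟨ cong (rank Y ℕ.+_) X-spans ⟩
        rank Y ℕ.+ rank X ∎

  private
    closed? : Subset n → Fin n → Bool
    closed? F e = if lookup F e then true else not (rank (F ∪ ⁅ e ⁆) ≡ᵇ rank F)

  Flat⇒closed : ∀ {F} → Flat F → ∀ e → F spans e → e ∈ F
  Flat⇒closed {F} flat e F-spans = go (allFin n) flat (∈-allFin e)
    where
      closed-at : closed? F e ≡ true → e ∈ F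
      closed-at eq with lookup F e in F[e]
      ... | true = lookup⇒[]= e F F[e]
      ... | false rewrite dec-true (rank (F ∪ ⁅ e ⁆) ℕP.≟ rank F) F-spans = ⊥-elim (false≢true eq)
      go : ∀ xs → foldr _∧_ true (map (closed? F) xs) ≡ true → e ∈ₗ xs → e ∈ F
      go (x ∷ xs) all (here refl) = closed-at (BoolP.∧-conicalˡ _ _ all)
      go (x ∷ xs) all (there e∈xs) = go xs (BoolP.∧-conicalʳ (closed? F x) _ all) e∈xs

  closed⇒Flat : ∀ {F} → (∀ e → F spans e → e ∈ F) → Flat F
  closed⇒Flat {F} closed = go (allFin n)
    where
      closed-at : ∀ e → closed? F e ≡ true
      closed-at e with lookup F e in F[e]
      ... | true = refl
      ... | false with rank (F ∪ ⁅ e ⁆) ≡ᵇ rank F in spans?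
      ...   | false = refl
      ...   | true = ⊥-elim (false≢true (trans (sym F[e])
                       ([]=⇒lookup (closed e (from-does (rank (F ∪ ⁅ e ⁆) ℕP.≟ rank F) spans?)))))
      go : ∀ xs → foldr _∧_ true (map (closed? F) xs) ≡ true
      go [] = refl
      go (x ∷ xs) = ∧-intro (closed-at x) (go xs)

  cl : Subset n → Subset n
  cl = closure M

  ∈cl⇒spans : ∀ {X e} → e ∈ cl X → X spans e
  ∈cl⇒spans {X} {e} e∈cl with lookup X e in X[e] | trans (sym (lookup∘tabulate _ e)) ([]=⇒lookup e∈cl)
  ... | true | _ = ∈⇒spans (lookup⇒[]= e X X[e])
  ... | false | spans? = from-does (rank (X ∪ ⁅ e ⁆) ℕP.≟ rank X) spans?

  spans⇒∈cl : ∀ {X e} → X spans e → e ∈ cl X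
  spans⇒∈cl {X} {e} X-spans = lookup⇒[]= e (cl X) (trans (lookup∘tabulate _ e) in-cl)
    where
      in-cl : (if lookup X e then true else (rank (X ∪ ⁅ e ⁆) ≡ᵇ rank X)) ≡ true
      in-cl with lookup X e
      ... | true = refl
      ... | false = dec-true (rank (X ∪ ⁅ e ⁆) ℕP.≟ rank X) X-spans

  ⊆cl : ∀ {X} → X ⊆ cl X
  ⊆cl x∈ = spans⇒∈cl (∈⇒spans x∈)

  private
    insertAll : Subset n → List (Fin n) → Subset n
    insertAll X [] = X
    insertAll X (e ∷ es) = insertAll X es ∪ ⁅ e ⁆

    ⊆insertAll : ∀ X es → X ⊆ insertAll X es
    ⊆insertAll X [] = ⊆-refl
    ⊆insertAll X (e ∷ es) x∈ = p⊆p∪q _ (⊆insertAll X es x∈)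

    ∈insertAll : ∀ X {e} es → e ∈ₗ es → e ∈ insertAll X es
    ∈insertAll X (e ∷ es) (here refl) = q⊆p∪q _ _ (x∈⁅x⁆ e)
    ∈insertAll X (_ ∷ es) (there e∈es) = p⊆p∪q _ (∈insertAll X es e∈es)

    rank-insertAll : ∀ X es → All (X spans_) es → rank (insertAll X es) ≡ rank X
    rank-insertAll X [] [] = refl
    rank-insertAll X (e ∷ es) (X-spans ∷ spanned) =
      trans (spans-mono (⊆insertAll X es) X-spans) (rank-insertAll X es spanned)

  rank-cl : ∀ X → rank (cl X) ≡ rank X
  rank-cl X = ℕP.≤-antisym (ℕP.≤-trans (rank-⊆ cl⊆) (ℕP.≤-reflexive (rank-insertAll X es spanned))) (rank-⊆ ⊆cl)
    where
      es = filter (_∈? cl X) (allFin n)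
      cl⊆ : cl X ⊆ insertAll X es
      cl⊆ {e} e∈ = ∈insertAll X es (∈-filter⁺ (_∈? cl X) (∈-allFin e) e∈)
      spanned : All (X spans_) es
      spanned = All.map ∈cl⇒spans (AllP.all-filter (_∈? cl X) (allFin n))

  Flat-cl : ∀ X → Flat (cl X)
  Flat-cl X = closed⇒Flat λ e cl-spans → spans⇒∈cl (ℕP.≤-antisym
    (ℕP.≤-trans (rank-⊆ (∪-lub (λ x∈ → p⊆p∪q _ (⊆cl x∈)) (q⊆p∪q _ _)))
                (ℕP.≤-reflexive (trans cl-spans (rank-cl X))))
    (rank-⊆ (p⊆p∪q _)))

  cl-least : ∀ {X G} → X ⊆ G → Flat G → cl X ⊆ G
  cl-least X⊆G flat {e} e∈ = Flat⇒closed flat e (spans-mono X⊆G (∈cl⇒spans e∈))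

  Flat-rank-unique : ∀ {S F F′} → Flat F → Flat F′ → S ⊆ F → S ⊆ F′ →
                     rank F ≡ rank S → rank F′ ≡ rank S → F ≡ F′
  Flat-rank-unique {S} fF fF′ S⊆F S⊆F′ rF rF′ = ⊆-antisym (⊆flat fF′ S⊆F′ S⊆F rF) (⊆flat fF S⊆F S⊆F′ rF′)
    where
      ⊆flat : ∀ {A B} → Flat A → S ⊆ A → S ⊆ B → rank B ≡ rank S → B ⊆ A
      ⊆flat fA S⊆A S⊆B rB {e} e∈B = Flat⇒closed fA e (spans-mono S⊆A (ℕP.≤-antisym
        (ℕP.≤-trans (rank-⊆ (∪-lub S⊆B (⁅x⁆⊆p e∈B))) (ℕP.≤-reflexive rB)) (rank-⊆ (p⊆p∪q _))))

  Flat-⊆-rank≤⇒≡ : ∀ {F G} → Flat F → Flat G → F ⊆ G → rank G ≤ rank F → F ≡ G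
  Flat-⊆-rank≤⇒≡ fF fG F⊆G rG≤rF = Flat-rank-unique fF fG ⊆-refl F⊆G refl (ℕP.≤-antisym rG≤rF (rank-⊆ F⊆G))

  Flat-⊂⇒rank< : ∀ {F G} → Flat F → Flat G → F ⊆ G → F ≢ G → rank F < rank G
  Flat-⊂⇒rank< fF fG F⊆G F≢G =
    ℕP.≤∧≢⇒< (rank-⊆ F⊆G) (λ rF≡rG → F≢G (Flat-⊆-rank≤⇒≡ fF fG F⊆G (ℕP.≤-reflexive (sym rF≡rG))))

  rank-0̂ : rank (0̂ M) ≡ 0
  rank-0̂ = trans (rank-cl ⊥) rank-⊥

  Flat-0̂ : Flat (0̂ M)
  Flat-0̂ = Flat-cl ⊥

  0̂⊆ : ∀ {F} → Flat F → 0̂ M ⊆ F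
  0̂⊆ = cl-least (⊆-min _)

  Flat-⊤ : Flat ⊤
  Flat-⊤ = closed⇒Flat (λ _ _ → ∈⊤)

  rank≡0⇒0̂≡ : ∀ {F} → Flat F → rank F ≡ 0 → 0̂ M ≡ F
  rank≡0⇒0̂≡ fF rF≡0 = Flat-⊆-rank≤⇒≡ Flat-0̂ fF (0̂⊆ fF) (ℕP.≤-reflexive (trans rF≡0 (sym rank-0̂)))

  cover : ∀ {F G} → Flat F → Flat G → F ⊆ G → F ≢ G →
          Σ (Subset n) λ A → Flat A × F ⊆ A × A ⊆ G × A ≢ F × rank A ≤ suc (rank F)
  cover {F} {G} fF fG F⊆G F≢G =
    A , Flat-cl _ , (λ x∈ → ⊆cl (p⊆p∪q _ x∈)) , cl-least (∪-lub F⊆G (⁅x⁆⊆p e∈G)) fG , A≢F , rank-A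
    where
      new : ∃ λ e → ¬ (e ∈ G → e ∈ F)
      new = ¬∀⟶∃¬ n _ (λ e → (e ∈? G) →-dec (e ∈? F)) (λ G⊆F → F≢G (⊆-antisym F⊆G (λ {e} → G⊆F e)))
      e = proj₁ new
      e∈G : e ∈ G
      e∈G = decidable-stable (e ∈? G) (λ e∉G → proj₂ new (λ e∈G → ⊥-elim (e∉G e∈G)))
      A = cl (F ∪ ⁅ e ⁆)
      A≢F : A ≢ F
      A≢F A≡F = proj₂ new (λ _ → subst (e ∈_) A≡F (⊆cl (q⊆p∪q _ _ (x∈⁅x⁆ e))))
      rank-A : rank A ≤ suc (rank F)
      rank-A = begin
          rank A                                         ≡⟨ rank-cl _ ⟩
          rank (F ∪ ⁅ e ⁆)                               ≤⟨ ℕP.m≤m+n _ _ ⟩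
          rank (F ∪ ⁅ e ⁆) ℕ.+ rank (F ∩ ⁅ e ⁆)          ≤⟨ rank-submod F ⁅ e ⁆ ⟩
          rank F ℕ.+ rank ⁅ e ⁆                          ≤⟨ ℕP.+-monoʳ-≤ (rank F) rank-⁅e⁆ ⟩
          rank F ℕ.+ 1                                   ≡⟨ ℕP.+-comm (rank F) 1 ⟩
          suc (rank F)                                   ∎
        where
          open ℕP.≤-Reasoning
          rank-⁅e⁆ : rank ⁅ e ⁆ ≤ 1
          rank-⁅e⁆ = ℕP.≤-trans (rank-≤ ⁅ e ⁆) (ℕP.≤-reflexive (∣⁅x⁆∣≡1 e))

-- The Möbius function

module Möbius {n : ℕ} (M : Matroid n) where
  open Matroid M
  open MatroidProperties M

  _∈ᵇ[_,_] : Subset n → Subset n → Subset n → Bool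
  H ∈ᵇ[ F , G ] = isFlat M H ∧ (F ⊆ᵇ H ∧ H ⊆ᵇ G)

  ∈ᵇ[]⇒ : ∀ {F G H} → H ∈ᵇ[ F , G ] ≡ true → Flat H × F ⊆ H × H ⊆ G
  ∈ᵇ[]⇒ {F} {G} {H} h =
    BoolP.∧-conicalˡ (isFlat M H) _ h ,
    from-does (F ⊆? H) (BoolP.∧-conicalˡ _ (H ⊆ᵇ G) (BoolP.∧-conicalʳ (isFlat M H) _ h)) ,
    from-does (H ⊆? G) (BoolP.∧-conicalʳ (F ⊆ᵇ H) _ (BoolP.∧-conicalʳ (isFlat M H) _ h))

  ⇒∈ᵇ[] : ∀ {F G H} → Flat H → F ⊆ H → H ⊆ G → H ∈ᵇ[ F , G ] ≡ true
  ⇒∈ᵇ[] {F} {G} {H} fH F⊆H H⊆G = ∧-intro fH (∧-intro (dec-true (F ⊆? H) F⊆H) (dec-true (H ⊆? G) H⊆G))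

  ∈ᵇ[]∧≢⇒ : ∀ {F G H} → (H ∈ᵇ[ F , G ] ∧ not (H ==ᵇ G)) ≡ true → Flat H × F ⊆ H × H ⊆ G × H ≢ G
  ∈ᵇ[]∧≢⇒ {F} {G} {H} h with ∈ᵇ[]⇒ {F} {G} {H} (BoolP.∧-conicalˡ _ _ h)
  ... | fH , F⊆H , H⊆G = fH , F⊆H , H⊆G , not-==ᵇ⇒≢ (BoolP.∧-conicalʳ (H ∈ᵇ[ F , G ]) _ h)

  Σ-flats : ∀ (f : Subset n → ℤ) → Σ[ flats M ] f ≡ Σₛ (λ X → ⟦ isFlat M X ⟧ f X)
  Σ-flats f = trans (Σ-filter (λ F → isFlat M F Data.Bool.≟ true) (allSubsets n) f)
                    (Σ-cong (allSubsets n) (λ X → cong (⟦_⟧ f X) (does-≟-true (isFlat M X))))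

  Σ-flats-nonneg : ∀ (f : Subset n → ℤ) → (∀ {F} → Flat F → 0ℤ ℤ.≤ f F) → 0ℤ ℤ.≤ Σ[ flats M ] f
  Σ-flats-nonneg f f≥0 = subst (0ℤ ℤ.≤_) (sym (Σ-flats f)) (Σ-nonneg (allSubsets n) _ guarded)
    where
      guarded : ∀ F → 0ℤ ℤ.≤ ⟦ isFlat M F ⟧ f F
      guarded F with isFlat M F in fF
      ... | true = f≥0 fF
      ... | false = ℤP.≤-refl

  Σ-interval : ∀ F G (f : Subset n → ℤ) → Σ[ interval M F G ] f ≡ Σₛ (λ H → ⟦ H ∈ᵇ[ F , G ] ⟧ f H)
  Σ-interval F G f = begin
      Σ[ filter (λ H → (F ⊆ᵇ H ∧ H ⊆ᵇ G) Data.Bool.≟ true) (flats M) ] f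
    ≡⟨ Σ-filter (λ H → (F ⊆ᵇ H ∧ H ⊆ᵇ G) Data.Bool.≟ true) (flats M) f ⟩
      Σ[ flats M ] (λ H → ⟦ does ((F ⊆ᵇ H ∧ H ⊆ᵇ G) Data.Bool.≟ true) ⟧ f H)
    ≡⟨ Σ-flats _ ⟩
      Σₛ (λ H → ⟦ isFlat M H ⟧ ⟦ does ((F ⊆ᵇ H ∧ H ⊆ᵇ G) Data.Bool.≟ true) ⟧ f H)
    ≡⟨ Σ-cong (allSubsets n) (λ H → trans (cong (λ b → ⟦ isFlat M H ⟧ ⟦ b ⟧ f H) (does-≟-true _))
                                         (⟦⟧-∧ (isFlat M H) _ (f H))) ⟩
      Σₛ (λ H → ⟦ H ∈ᵇ[ F , G ] ⟧ f H) ∎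
    where open ≡-Reasoning

  Σ-interval⁻ : ∀ F G (f : Subset n → ℤ) →
    Σ[ filter (λ H → not (H ==ᵇ G) Data.Bool.≟ true) (interval M F G) ] f ≡
    Σₛ (λ H → ⟦ H ∈ᵇ[ F , G ] ∧ not (H ==ᵇ G) ⟧ f H)
  Σ-interval⁻ F G f =
    trans (Σ-filter (λ H → not (H ==ᵇ G) Data.Bool.≟ true) (interval M F G) f)
    (trans (Σ-interval F G _)
    (Σ-cong (allSubsets n) (λ H → trans (cong (λ b → ⟦ H ∈ᵇ[ F , G ] ⟧ ⟦ b ⟧ f H) (does-≟-true _))
                                        (⟦⟧-∧ (H ∈ᵇ[ F , G ]) _ (f H)))))

  rank≤n : ∀ X → rank X ≤ n
  rank≤n X = ℕP.≤-trans (rank-≤ X) (∣p∣≤n X)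

  -- The fuel of mob only has to exceed the length of the longest chain of flats.
  mob-fuel : ∀ k k′ F G → Flat F → Flat G →
             rank G ∸ rank F < k → rank G ∸ rank F < k′ → mob M k F G ≡ mob M k′ F G
  mob-fuel (suc k) (suc k′) F G fF fG d<k d<k′ with F ⊆ᵇ G
  ... | false = refl
  ... | true with F ==ᵇ G
  ...   | true = refl
  ...   | false = cong -_ (trans (Σ-interval⁻ F G (mob M k F))
                  (trans (Σₛ-⟦⟧-cong (λ H → H ∈ᵇ[ F , G ] ∧ not (H ==ᵇ G)) (mob M k F) (mob M k′ F) below)
                  (sym (Σ-interval⁻ F G (mob M k′ F)))))
    where
      below : ∀ H → (H ∈ᵇ[ F , G ] ∧ not (H ==ᵇ G)) ≡ true → mob M k F H ≡ mob M k′ F H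
      below H h with ∈ᵇ[]∧≢⇒ {F} {G} {H} h
      ... | fH , F⊆H , H⊆G , H≢G =
        mob-fuel k k′ F H fF fH (ℕP.<-≤-trans d< (ℕP.≤-pred d<k)) (ℕP.<-≤-trans d< (ℕP.≤-pred d<k′))
        where d< : rank H ∸ rank F < rank G ∸ rank F
              d< = ℕP.∸-monoˡ-< (Flat-⊂⇒rank< fH fG H⊆G H≢G) (rank-⊆ F⊆H)

  μ-unfold : ∀ {F G} → Flat F → Flat G → F ⊆ G → F ≢ G →
             μ M F G ≡ - Σₛ (λ H → ⟦ H ∈ᵇ[ F , G ] ∧ not (H ==ᵇ G) ⟧ μ M F H)
  μ-unfold {F} {G} fF fG F⊆G F≢G rewrite dec-true (F ⊆? G) F⊆G | dec-false (F ≟ₛ G) F≢G =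
    cong -_ (trans (Σ-interval⁻ F G (mob M n F))
                   (Σₛ-⟦⟧-cong (λ H → H ∈ᵇ[ F , G ] ∧ not (H ==ᵇ G)) (mob M n F) (μ M F) below))
    where
      below : ∀ H → (H ∈ᵇ[ F , G ] ∧ not (H ==ᵇ G)) ≡ true → mob M n F H ≡ μ M F H
      below H h with ∈ᵇ[]∧≢⇒ {F} {G} {H} h
      ... | fH , F⊆H , H⊆G , H≢G = mob-fuel n (suc n) F H fF fH d<n (ℕP.m≤n⇒m≤1+n d<n)
        where d<n : rank H ∸ rank F < n
              d<n = ℕP.≤-<-trans (ℕP.m∸n≤m (rank H) (rank F))
                                 (ℕP.<-≤-trans (Flat-⊂⇒rank< fH fG H⊆G H≢G) (rank≤n G))

  μ-refl : ∀ F → μ M F F ≡ 1ℤ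
  μ-refl F rewrite dec-true (F ⊆? F) ⊆-refl | dec-true (F ≟ₛ F) refl = refl

  μ-⊈ : ∀ {F G} → ¬ F ⊆ G → μ M F G ≡ 0ℤ
  μ-⊈ {F} {G} F⊈G rewrite dec-false (F ⊆? G) F⊈G = refl

  Σμ≡0 : ∀ {F G} → Flat F → Flat G → F ⊆ G → F ≢ G → Σₛ (λ H → ⟦ H ∈ᵇ[ F , G ] ⟧ μ M F H) ≡ 0ℤ
  Σμ≡0 {F} {G} fF fG F⊆G F≢G = begin
      Σₛ (λ H → ⟦ H ∈ᵇ[ F , G ] ⟧ μ M F H)
    ≡⟨ Σₛ-split G (λ H → ⟦ H ∈ᵇ[ F , G ] ⟧ μ M F H) ⟩
      ⟦ G ∈ᵇ[ F , G ] ⟧ μ M F G + Σₛ (λ H → ⟦ not (H ==ᵇ G) ⟧ ⟦ H ∈ᵇ[ F , G ] ⟧ μ M F H)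
    ≡⟨ cong₂ _+_ (⟦⟧-true (μ M F G) (⇒∈ᵇ[] fG F⊆G ⊆-refl)) (Σ-cong (allSubsets n) swap) ⟩
      μ M F G + T
    ≡⟨ cong (_+ T) (μ-unfold fF fG F⊆G F≢G) ⟩
      - T + T
    ≡⟨ ℤP.+-inverseˡ T ⟩
      0ℤ ∎
    where
      open ≡-Reasoning
      T = Σₛ (λ H → ⟦ H ∈ᵇ[ F , G ] ∧ not (H ==ᵇ G) ⟧ μ M F H)
      swap : ∀ H → ⟦ not (H ==ᵇ G) ⟧ ⟦ H ∈ᵇ[ F , G ] ⟧ μ M F H ≡ ⟦ H ∈ᵇ[ F , G ] ∧ not (H ==ᵇ G) ⟧ μ M F H
      swap H = trans (⟦⟧-∧ (not (H ==ᵇ G)) (H ∈ᵇ[ F , G ]) (μ M F H))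
                     (cong (⟦_⟧ μ M F H) (BoolP.∧-comm (not (H ==ᵇ G)) (H ∈ᵇ[ F , G ])))

  μ-atom : ∀ {H} → Flat H → rank H ≡ 1 → μ M (0̂ M) H ≡ - 1ℤ
  μ-atom {H} fH rH≡1 = trans (μ-unfold Flat-0̂ fH (0̂⊆ fH) 0̂≢H) (cong -_ (begin
      Σₛ (λ X → ⟦ below X ⟧ μ M (0̂ M) X) ≡⟨ Σₛ-⟦⟧-point below (μ M (0̂ M)) (0̂ M) only-0̂ ⟩
      ⟦ below (0̂ M) ⟧ μ M (0̂ M) (0̂ M)   ≡⟨ ⟦⟧-true _ 0̂-below ⟩
      μ M (0̂ M) (0̂ M)                   ≡⟨ μ-refl (0̂ M) ⟩
      1ℤ                                ∎))
    where
      open ≡-Reasoning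
      below : Subset n → Bool
      below X = X ∈ᵇ[ 0̂ M , H ] ∧ not (X ==ᵇ H)
      0̂≢H : 0̂ M ≢ H
      0̂≢H 0̂≡H = ℕP.0≢1+n (trans (sym rank-0̂) (trans (cong rank 0̂≡H) rH≡1))
      only-0̂ : ∀ X → below X ≡ true → X ≡ 0̂ M
      only-0̂ X h with ∈ᵇ[]∧≢⇒ {0̂ M} {H} {X} h
      ... | fX , _ , X⊆H , X≢H =
        sym (rank≡0⇒0̂≡ fX (ℕP.n<1⇒n≡0 (subst (rank X <_) rH≡1 (Flat-⊂⇒rank< fX fH X⊆H X≢H))))
      0̂-below : below (0̂ M) ≡ true
      0̂-below = ∧-intro (⇒∈ᵇ[] Flat-0̂ ⊆-refl (0̂⊆ fH)) (cong not (dec-false (0̂ M ≟ₛ H) 0̂≢H))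

  χ-constant : ∀ {F G} → Flat G → F ⊆ G → χ M F G 0 ≡ μ M F G
  χ-constant {F} {G} fG F⊆G = begin
      χ M F G 0
    ≡⟨ Σ-interval F G _ ⟩
      Σₛ (λ H → ⟦ H ∈ᵇ[ F , G ] ⟧ ⟦ (rank G ∸ rank H) ≡ᵇ 0 ⟧ μ M F H)
    ≡⟨ Σ-cong (allSubsets n) (λ H → ⟦⟧-∧ (H ∈ᵇ[ F , G ]) _ (μ M F H)) ⟩
      Σₛ (λ H → ⟦ top H ⟧ μ M F H)
    ≡⟨ Σₛ-⟦⟧-point top (μ M F) G only-G ⟩
      ⟦ top G ⟧ μ M F G
    ≡⟨ ⟦⟧-true _ G-top ⟩
      μ M F G ∎
    where
      open ≡-Reasoning
      top : Subset n → Bool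
      top H = H ∈ᵇ[ F , G ] ∧ ((rank G ∸ rank H) ≡ᵇ 0)
      only-G : ∀ H → top H ≡ true → H ≡ G
      only-G H h with ∈ᵇ[]⇒ {F} {G} {H} (BoolP.∧-conicalˡ _ _ h)
      ... | fH , _ , H⊆G = Flat-⊆-rank≤⇒≡ fH fG H⊆G
        (ℕP.m∸n≡0⇒m≤n (from-does (rank G ∸ rank H ℕP.≟ 0) (BoolP.∧-conicalʳ (H ∈ᵇ[ F , G ]) _ h)))
      G-top : top G ≡ true
      G-top = ∧-intro (⇒∈ᵇ[] fG F⊆G ⊆-refl) (dec-true (rank G ∸ rank G ℕP.≟ 0) (ℕP.n∸n≡0 (rank G)))

  Σ-rank0 : ∀ {H} → Flat H → (f : Subset n → ℤ) → Σₛ (λ X → ⟦ X ∈ᵇ[ 0̂ M , H ] ⟧ ⟦ rank X ≡ᵇ 0 ⟧ f X) ≡ f (0̂ M)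
  Σ-rank0 {H} fH f = begin
      Σₛ (λ X → ⟦ X ∈ᵇ[ 0̂ M , H ] ⟧ ⟦ rank X ≡ᵇ 0 ⟧ f X)
    ≡⟨ Σ-cong (allSubsets n) (λ X → ⟦⟧-∧ (X ∈ᵇ[ 0̂ M , H ]) (rank X ≡ᵇ 0) (f X)) ⟩
      Σₛ (λ X → ⟦ bottom X ⟧ f X)
    ≡⟨ Σₛ-⟦⟧-point bottom f (0̂ M) only-0̂ ⟩
      ⟦ bottom (0̂ M) ⟧ f (0̂ M)
    ≡⟨ ⟦⟧-true _ 0̂-bottom ⟩
      f (0̂ M) ∎
    where
      open ≡-Reasoning
      bottom : Subset n → Bool
      bottom X = X ∈ᵇ[ 0̂ M , H ] ∧ (rank X ≡ᵇ 0)
      only-0̂ : ∀ X → bottom X ≡ true → X ≡ 0̂ M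
      only-0̂ X h = sym (rank≡0⇒0̂≡ (proj₁ (∈ᵇ[]⇒ {0̂ M} {H} {X} (BoolP.∧-conicalˡ _ _ h)))
                                  (from-does (rank X ℕP.≟ 0) (BoolP.∧-conicalʳ (X ∈ᵇ[ 0̂ M , H ]) _ h)))
      0̂-bottom : bottom (0̂ M) ≡ true
      0̂-bottom = ∧-intro (⇒∈ᵇ[] Flat-0̂ ⊆-refl (0̂⊆ fH)) (dec-true (rank (0̂ M) ℕP.≟ 0) rank-0̂)

-- Weisner's theorem and the alternation of signs of μ

module Weisner {n : ℕ} (M : Matroid n) {F A : Subset n}
               (fF : isFlat M F ≡ true) (F⊆A : F ⊆ A) (A≢F : A ≢ F) where
  open Matroid M
  open MatroidProperties M
  open Möbius M

  -- Encodes x ∨ A = z as a rank equality: z is the only flat of its rank containing x ∪ A.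
  joins : Subset n → Subset n → Bool
  joins z x = x ∈ᵇ[ F , z ] ∧ (rank (x ∪ A) ≡ᵇ rank z)

  joinSum : Subset n → ℤ
  joinSum z = Σₛ (λ x → ⟦ joins z x ⟧ μ M F x)

  private
    ∈ᵇ[A,y]∧joins⇒ : ∀ {x y z} → (z ∈ᵇ[ A , y ] ∧ joins z x) ≡ true →
                     z ≡ cl (x ∪ A) × Flat x × F ⊆ x × x ⊆ y
    ∈ᵇ[A,y]∧joins⇒ {x} {y} {z} h with ∈ᵇ[]⇒ {A} {y} {z} (BoolP.∧-conicalˡ _ _ h)
    ... | fz , A⊆z , z⊆y with BoolP.∧-conicalʳ (z ∈ᵇ[ A , y ]) _ h
    ... | h′ with ∈ᵇ[]⇒ {F} {z} {x} (BoolP.∧-conicalˡ _ _ h′)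
    ... | fx , F⊆x , x⊆z =
      Flat-rank-unique fz (Flat-cl _) (∪-lub x⊆z A⊆z) ⊆cl
        (sym (from-does (rank (x ∪ A) ℕP.≟ rank z) (BoolP.∧-conicalʳ (x ∈ᵇ[ F , z ]) _ h′))) (rank-cl _) ,
      fx , F⊆x , ⊆-trans x⊆z z⊆y

  Σμ≡ΣjoinSum : ∀ {y} → Flat y → A ⊆ y →
                Σₛ (λ x → ⟦ x ∈ᵇ[ F , y ] ⟧ μ M F x) ≡ Σₛ (λ z → ⟦ z ∈ᵇ[ A , y ] ⟧ joinSum z)
  Σμ≡ΣjoinSum {y} fy A⊆y = sym (begin
      Σₛ (λ z → ⟦ z ∈ᵇ[ A , y ] ⟧ joinSum z)
    ≡⟨ Σ-cong (allSubsets n) (λ z → ⟦⟧-Σ (allSubsets n) (z ∈ᵇ[ A , y ]) (λ x → ⟦ joins z x ⟧ μ M F x)) ⟩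
      Σₛ (λ z → Σₛ (λ x → ⟦ z ∈ᵇ[ A , y ] ⟧ ⟦ joins z x ⟧ μ M F x))
    ≡⟨ Σ-comm (allSubsets n) (allSubsets n) (λ z x → ⟦ z ∈ᵇ[ A , y ] ⟧ ⟦ joins z x ⟧ μ M F x) ⟩
      Σₛ (λ x → Σₛ (λ z → ⟦ z ∈ᵇ[ A , y ] ⟧ ⟦ joins z x ⟧ μ M F x))
    ≡⟨ Σ-cong (allSubsets n) (λ x → trans (Σ-cong (allSubsets n) (λ z → ⟦⟧-∧ (z ∈ᵇ[ A , y ]) (joins z x) (μ M F x)))
                                          (only-join x)) ⟩
      Σₛ (λ x → ⟦ x ∈ᵇ[ F , y ] ⟧ μ M F x) ∎)
    where
      open ≡-Reasoning
      only-join : ∀ x → Σₛ (λ z → ⟦ z ∈ᵇ[ A , y ] ∧ joins z x ⟧ μ M F x) ≡ ⟦ x ∈ᵇ[ F , y ] ⟧ μ M F x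
      only-join x = trans
        (Σₛ-⟦⟧-point (λ z → z ∈ᵇ[ A , y ] ∧ joins z x) (λ _ → μ M F x) (cl (x ∪ A))
                     (λ z h → proj₁ (∈ᵇ[A,y]∧joins⇒ {x} {y} {z} h)))
        (cong (⟦_⟧ μ M F x) (true⇔true⇒≡ ⇒x∈ x∈⇒))
        where
          x∪A⊆ = ⊆cl {x ∪ A}
          ⇒x∈ : (cl (x ∪ A) ∈ᵇ[ A , y ] ∧ joins (cl (x ∪ A)) x) ≡ true → x ∈ᵇ[ F , y ] ≡ true
          ⇒x∈ h with ∈ᵇ[A,y]∧joins⇒ {x} {y} {cl (x ∪ A)} h
          ... | _ , fx , F⊆x , x⊆y = ⇒∈ᵇ[] fx F⊆x x⊆y
          x∈⇒ : x ∈ᵇ[ F , y ] ≡ true → (cl (x ∪ A) ∈ᵇ[ A , y ] ∧ joins (cl (x ∪ A)) x) ≡ true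
          x∈⇒ h with ∈ᵇ[]⇒ {F} {y} {x} h
          ... | fx , F⊆x , x⊆y =
            ∧-intro (⇒∈ᵇ[] (Flat-cl _) (λ a∈ → x∪A⊆ (q⊆p∪q _ _ a∈)) (cl-least (∪-lub x⊆y A⊆y) fy))
                    (∧-intro (⇒∈ᵇ[] fx F⊆x (λ a∈ → x∪A⊆ (p⊆p∪q _ a∈)))
                             (dec-true (rank (x ∪ A) ℕP.≟ rank (cl (x ∪ A))) (sym (rank-cl _))))

  joinSum≡0 : ∀ {y} → Flat y → A ⊆ y → joinSum y ≡ 0ℤ
  joinSum≡0 {y} fy A⊆y = go (suc (rank y)) fy A⊆y (ℕP.n<1+n _)
    where
      go : ∀ m {y} → Flat y → A ⊆ y → rank y < m → joinSum y ≡ 0ℤ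
      go (suc m) {y} fy A⊆y ry<1+m = begin
          joinSum y
        ≡⟨ sym (ℤP.+-identityʳ _) ⟩
          joinSum y + 0ℤ
        ≡⟨ cong₂ _+_ (sym (⟦⟧-true _ (⇒∈ᵇ[] fy A⊆y ⊆-refl))) (sym (Σₛ-⟦⟧-zero _ _ below)) ⟩
          ⟦ y ∈ᵇ[ A , y ] ⟧ joinSum y + Σₛ (λ z → ⟦ not (z ==ᵇ y) ⟧ ⟦ z ∈ᵇ[ A , y ] ⟧ joinSum z)
        ≡⟨ sym (Σₛ-split y (λ z → ⟦ z ∈ᵇ[ A , y ] ⟧ joinSum z)) ⟩
          Σₛ (λ z → ⟦ z ∈ᵇ[ A , y ] ⟧ joinSum z)
        ≡⟨ sym (Σμ≡ΣjoinSum fy A⊆y) ⟩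
          Σₛ (λ x → ⟦ x ∈ᵇ[ F , y ] ⟧ μ M F x)
        ≡⟨ Σμ≡0 fF fy (⊆-trans F⊆A A⊆y) F≢y ⟩
          0ℤ ∎
        where
          open ≡-Reasoning
          F≢y : F ≢ y
          F≢y F≡y = A≢F (⊆-antisym (subst (A ⊆_) (sym F≡y) A⊆y) F⊆A)
          below : ∀ z → not (z ==ᵇ y) ≡ true → ⟦ z ∈ᵇ[ A , y ] ⟧ joinSum z ≡ 0ℤ
          below z z≢y with z ∈ᵇ[ A , y ] in z∈
          ... | false = refl
          ... | true with ∈ᵇ[]⇒ {A} {y} {z} z∈
          ... | fz , A⊆z , z⊆y =
            go m fz A⊆z (ℕP.<-≤-trans (Flat-⊂⇒rank< fz fy z⊆y (not-==ᵇ⇒≢ z≢y)) (ℕP.≤-pred ry<1+m))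

  μ≡-Σjoins : ∀ {G} → Flat G → A ⊆ G → F ⊆ G →
              μ M F G ≡ - Σₛ (λ x → ⟦ not (x ==ᵇ G) ⟧ ⟦ joins G x ⟧ μ M F x)
  μ≡-Σjoins {G} fG A⊆G F⊆G = inverseˡ-unique (μ M F G) _ (begin
      μ M F G + Σₛ (λ x → ⟦ not (x ==ᵇ G) ⟧ ⟦ joins G x ⟧ μ M F x)
    ≡⟨ cong (_+ Σₛ (λ x → ⟦ not (x ==ᵇ G) ⟧ ⟦ joins G x ⟧ μ M F x)) (sym (⟦⟧-true _ joins-G)) ⟩
      ⟦ joins G G ⟧ μ M F G + Σₛ (λ x → ⟦ not (x ==ᵇ G) ⟧ ⟦ joins G x ⟧ μ M F x)
    ≡⟨ sym (Σₛ-split G (λ x → ⟦ joins G x ⟧ μ M F x)) ⟩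
      joinSum G
    ≡⟨ joinSum≡0 fG A⊆G ⟩
      0ℤ ∎)
    where
      open ≡-Reasoning
      joins-G : joins G G ≡ true
      joins-G = ∧-intro (⇒∈ᵇ[] fG F⊆G ⊆-refl)
        (dec-true (rank (G ∪ A) ℕP.≟ rank G) (ℕP.≤-antisym (rank-⊆ (∪-lub ⊆-refl A⊆G)) (rank-⊆ (p⊆p∪q _))))

  -- Semimodularity: x ∨ A covers x because A covers F.
  joins-coatom : rank A ≤ suc (rank F) → ∀ {G x} → Flat G → (not (x ==ᵇ G) ∧ joins G x) ≡ true →
                 Flat x × F ⊆ x × suc (rank x) ≡ rank G
  joins-coatom rA≤1+rF {G} {x} fG h with ∈ᵇ[]⇒ {F} {G} {x} (BoolP.∧-conicalˡ _ _ (BoolP.∧-conicalʳ (not (x ==ᵇ G)) _ h))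
  ... | fx , F⊆x , x⊆G = fx , F⊆x , ℕP.≤-antisym (Flat-⊂⇒rank< fx fG x⊆G x≢G) rG≤1+rx
    where
      open ℕP.≤-Reasoning
      x≢G : x ≢ G
      x≢G = not-==ᵇ⇒≢ (BoolP.∧-conicalˡ _ _ h)
      x∨A≡G : rank (x ∪ A) ≡ rank G
      x∨A≡G = from-does (rank (x ∪ A) ℕP.≟ rank G)
                (BoolP.∧-conicalʳ (x ∈ᵇ[ F , G ]) _ (BoolP.∧-conicalʳ (not (x ==ᵇ G)) _ h))
      rG≤1+rx : rank G ≤ suc (rank x)
      rG≤1+rx = ℕP.+-cancelʳ-≤ (rank F) _ _ (begin
        rank G ℕ.+ rank F             ≤⟨ ℕP.+-mono-≤ (ℕP.≤-reflexive (sym x∨A≡G)) (rank-⊆ (∩-glb F⊆x F⊆A)) ⟩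
        rank (x ∪ A) ℕ.+ rank (x ∩ A) ≤⟨ rank-submod x A ⟩
        rank x ℕ.+ rank A             ≤⟨ ℕP.+-monoʳ-≤ (rank x) rA≤1+rF ⟩
        rank x ℕ.+ suc (rank F)       ≡⟨ ℕP.+-suc (rank x) (rank F) ⟩
        suc (rank x) ℕ.+ rank F       ∎)

module MöbiusSign {n : ℕ} (M : Matroid n) where
  open Matroid M
  open MatroidProperties M
  open Möbius M

  -- Weisner: for an atom A of [F, G], μ F G = - Σ μ F x over the coatoms x of [F, G] with x ∨ A = G.
  sgn*μ-step : ∀ {F G} → Flat F → Flat G → F ⊆ G → F ≢ G →
               (∀ {x} → Flat x → F ⊆ x → suc (rank x) ≡ rank G → 0ℤ ℤ.≤ sgn (rank x ∸ rank F) * μ M F x) →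
               0ℤ ℤ.≤ sgn (rank G ∸ rank F) * μ M F G
  sgn*μ-step {F} {G} fF fG F⊆G F≢G coatoms-nonneg with cover fF fG F⊆G F≢G
  ... | A , _ , F⊆A , A⊆G , A≢F , rA≤1+rF = begin
      0ℤ                              ≤⟨ T-nonneg ⟩
      sgn d * T                       ≡⟨ neg*neg (sgn d) T ⟩
      sgn (suc d) * - T               ≡⟨ cong₂ (λ k v → sgn k * v) (sym rG∸rF) (sym (μ≡-Σjoins fG A⊆G F⊆G)) ⟩
      sgn (rank G ∸ rank F) * μ M F G ∎
    where
      open Weisner M fF F⊆A A≢F
      open ℤP.≤-Reasoning
      T = Σₛ (λ x → ⟦ not (x ==ᵇ G) ⟧ ⟦ joins G x ⟧ μ M F x)
      d = ℕ.pred (rank G ∸ rank F)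
      rG∸rF : rank G ∸ rank F ≡ suc d
      rG∸rF = sym (ℕP.suc-pred _ {{ℕ.>-nonZero (ℕP.m<n⇒0<n∸m (Flat-⊂⇒rank< fF fG F⊆G F≢G))}})
      term-nonneg : ∀ x → 0ℤ ℤ.≤ sgn d * ⟦ not (x ==ᵇ G) ⟧ ⟦ joins G x ⟧ μ M F x
      term-nonneg x rewrite ⟦⟧-∧ (not (x ==ᵇ G)) (joins G x) (μ M F x) with not (x ==ᵇ G) ∧ joins G x in h
      ... | false = ℤP.≤-reflexive (sym (ℤP.*-zeroʳ (sgn d)))
      ... | true with joins-coatom rA≤1+rF fG h
      ... | fx , F⊆x , 1+rx≡rG = subst (λ k → 0ℤ ℤ.≤ sgn k * μ M F x) rx∸rF (coatoms-nonneg fx F⊆x 1+rx≡rG)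
        where rx∸rF : rank x ∸ rank F ≡ d
              rx∸rF = cong ℕ.pred (trans (sym (ℕP.+-∸-assoc 1 (rank-⊆ F⊆x))) (cong (_∸ rank F) 1+rx≡rG))
      T-nonneg : 0ℤ ℤ.≤ sgn d * T
      T-nonneg = subst (0ℤ ℤ.≤_) (Σ-*ˡ (allSubsets n) (sgn d) _) (Σ-nonneg (allSubsets n) _ term-nonneg)
      neg*neg : ∀ s t → s * t ≡ (- s) * (- t)
      neg*neg = solve-∀

  sgn*μ≥0 : ∀ {F G} → Flat F → Flat G → F ⊆ G → 0ℤ ℤ.≤ sgn (rank G ∸ rank F) * μ M F G
  sgn*μ≥0 {F} {G} fF fG F⊆G = go (suc (rank G)) fG F⊆G (ℕP.n<1+n _)
    where
      go : ∀ m {G} → Flat G → F ⊆ G → rank G < m → 0ℤ ℤ.≤ sgn (rank G ∸ rank F) * μ M F G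
      go (suc m) {G} fG F⊆G rG<1+m = by-cases (F ≟ₛ G)
        where
          by-cases : Dec (F ≡ G) → 0ℤ ℤ.≤ sgn (rank G ∸ rank F) * μ M F G
          by-cases (yes refl) =
            subst₂ (λ k v → 0ℤ ℤ.≤ sgn k * v) (sym (ℕP.n∸n≡0 (rank F))) (sym (μ-refl F)) (ℤ.+≤+ z≤n)
          by-cases (no F≢G) = sgn*μ-step fF fG F⊆G F≢G λ fx F⊆x 1+rx≡rG →
            go m fx F⊆x (ℕP.≤-trans (ℕP.≤-reflexive 1+rx≡rG) (ℕP.≤-pred rG<1+m))

module WhitneyNumbers {n : ℕ} (M : Matroid n) where
  open Matroid M
  open MatroidProperties M
  open Möbius M
  open MöbiusSign M

  sgn*w≥0 : ∀ i j → 0ℤ ℤ.≤ sgn (j ∸ i) * w M (+ i) (+ j)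
  sgn*w≥0 i j = subst (0ℤ ℤ.≤_) (Σ-*ˡ (flats M) s _) (Σ-flats-nonneg _ λ {F} fF →
                subst (0ℤ ℤ.≤_) (Σ-*ˡ (flats M) s _) (Σ-flats-nonneg _ λ {G} fG → term fF fG))
    where
      s = sgn (j ∸ i)
      term : ∀ {F G} → Flat F → Flat G → 0ℤ ℤ.≤ s * ⟦ (rank F ≡ᵇ i) ∧ (rank G ≡ᵇ j) ⟧ μ M F G
      term {F} {G} fF fG with (rank F ≡ᵇ i) ∧ (rank G ≡ᵇ j) in ranks
      ... | false = ℤP.≤-reflexive (sym (ℤP.*-zeroʳ s))
      ... | true = by-cases (F ⊆? G)
        where
          by-cases : Dec (F ⊆ G) → 0ℤ ℤ.≤ s * μ M F G
          by-cases (no F⊈G) = subst (λ v → 0ℤ ℤ.≤ s * v) (sym (μ-⊈ F⊈G)) (ℤP.≤-reflexive (sym (ℤP.*-zeroʳ s)))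
          by-cases (yes F⊆G) = subst₂ (λ a b → 0ℤ ℤ.≤ sgn (b ∸ a) * μ M F G)
            (from-does (rank F ℕP.≟ i) (BoolP.∧-conicalˡ _ _ ranks))
            (from-does (rank G ℕP.≟ j) (BoolP.∧-conicalʳ (rank F ≡ᵇ i) _ ranks))
            (sgn*μ≥0 fF fG F⊆G)

  χ-coeff≡Σμ : ∀ F j → j ≤ rank ⊤ → χ M F ⊤ (rank ⊤ ∸ j) ≡ Σ[ flats M ] (λ G → ⟦ rank G ≡ᵇ j ⟧ μ M F G)
  χ-coeff≡Σμ F j j≤r = begin
      χ M F ⊤ (rank ⊤ ∸ j)
    ≡⟨ Σ-interval F ⊤ _ ⟩
      Σₛ (λ G → ⟦ G ∈ᵇ[ F , ⊤ ] ⟧ ⟦ (rank ⊤ ∸ rank G) ≡ᵇ (rank ⊤ ∸ j) ⟧ μ M F G)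
    ≡⟨ Σ-cong (allSubsets n) pointwise ⟩
      Σₛ (λ G → ⟦ isFlat M G ⟧ ⟦ rank G ≡ᵇ j ⟧ μ M F G)
    ≡⟨ sym (Σ-flats _) ⟩
      Σ[ flats M ] (λ G → ⟦ rank G ≡ᵇ j ⟧ μ M F G) ∎
    where
      open ≡-Reasoning
      r∸-≡ᵇ : ∀ g → g ≤ rank ⊤ → ((rank ⊤ ∸ g) ≡ᵇ (rank ⊤ ∸ j)) ≡ (g ≡ᵇ j)
      r∸-≡ᵇ g g≤r = true⇔true⇒≡
        (λ h → dec-true (g ℕP.≟ j) (ℕP.∸-cancelˡ-≡ g≤r j≤r (from-does (rank ⊤ ∸ g ℕP.≟ rank ⊤ ∸ j) h)))
        (λ h → dec-true (rank ⊤ ∸ g ℕP.≟ rank ⊤ ∸ j) (cong (rank ⊤ ∸_) (from-does (g ℕP.≟ j) h)))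
      pointwise : ∀ G → ⟦ G ∈ᵇ[ F , ⊤ ] ⟧ ⟦ (rank ⊤ ∸ rank G) ≡ᵇ (rank ⊤ ∸ j) ⟧ μ M F G
                        ≡ ⟦ isFlat M G ⟧ ⟦ rank G ≡ᵇ j ⟧ μ M F G
      pointwise G = trans (sym (⟦⟧-∧ (isFlat M G) _ _)) (cong (⟦ isFlat M G ⟧_) (by-cases (F ⊆? G)))
        where
          by-cases : Dec (F ⊆ G) →
                     ⟦ F ⊆ᵇ G ∧ G ⊆ᵇ ⊤ ⟧ ⟦ (rank ⊤ ∸ rank G) ≡ᵇ (rank ⊤ ∸ j) ⟧ μ M F G ≡ ⟦ rank G ≡ᵇ j ⟧ μ M F G
          by-cases (no F⊈G) rewrite μ-⊈ F⊈G = trans (cong (⟦ F ⊆ᵇ G ∧ G ⊆ᵇ ⊤ ⟧_) (⟦⟧-0 _))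
                                                       (trans (⟦⟧-0 _) (sym (⟦⟧-0 _)))
          by-cases (yes F⊆G) rewrite dec-true (F ⊆? G) F⊆G | dec-true (G ⊆? ⊤) ⊆⊤
                                   | r∸-≡ᵇ (rank G) (rank≤rank⊤ G) = refl

  ∈ᵇ[0̂,⊤]≡isFlat : ∀ F → F ∈ᵇ[ 0̂ M , ⊤ ] ≡ isFlat M F
  ∈ᵇ[0̂,⊤]≡isFlat F = true⇔true⇒≡ (λ h → proj₁ (∈ᵇ[]⇒ {0̂ M} {⊤} {F} h)) (λ fF → ⇒∈ᵇ[] fF (0̂⊆ fF) ⊆⊤)

  Σχ≡w : ∀ i j → j ≤ rank ⊤ →
         Σₛ (λ F → ⟦ F ∈ᵇ[ 0̂ M , ⊤ ] ⟧ ⟦ rank F ≡ᵇ i ⟧ χ M F ⊤ (rank ⊤ ∸ j)) ≡ w M (+ i) (+ j)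
  Σχ≡w i j j≤r = trans (Σ-cong (allSubsets n) pointwise) (sym (Σ-flats _))
    where
      pointwise : ∀ F → ⟦ F ∈ᵇ[ 0̂ M , ⊤ ] ⟧ ⟦ rank F ≡ᵇ i ⟧ χ M F ⊤ (rank ⊤ ∸ j)
                        ≡ ⟦ isFlat M F ⟧ Σ[ flats M ] (λ G → ⟦ (rank F ≡ᵇ i) ∧ (rank G ≡ᵇ j) ⟧ μ M F G)
      pointwise F = begin
          ⟦ F ∈ᵇ[ 0̂ M , ⊤ ] ⟧ ⟦ rank F ≡ᵇ i ⟧ χ M F ⊤ (rank ⊤ ∸ j)
        ≡⟨ cong₂ (λ b v → ⟦ b ⟧ ⟦ rank F ≡ᵇ i ⟧ v) (∈ᵇ[0̂,⊤]≡isFlat F) (χ-coeff≡Σμ F j j≤r) ⟩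
          ⟦ isFlat M F ⟧ ⟦ rank F ≡ᵇ i ⟧ Σ[ flats M ] (λ G → ⟦ rank G ≡ᵇ j ⟧ μ M F G)
        ≡⟨ cong (⟦ isFlat M F ⟧_) (⟦⟧-Σ (flats M) (rank F ≡ᵇ i) _) ⟩
          ⟦ isFlat M F ⟧ Σ[ flats M ] (λ G → ⟦ rank F ≡ᵇ i ⟧ ⟦ rank G ≡ᵇ j ⟧ μ M F G)
        ≡⟨ cong (⟦ isFlat M F ⟧_) (Σ-cong (flats M) (λ G → ⟦⟧-∧ (rank F ≡ᵇ i) (rank G ≡ᵇ j) (μ M F G))) ⟩
          ⟦ isFlat M F ⟧ Σ[ flats M ] (λ G → ⟦ (rank F ≡ᵇ i) ∧ (rank G ≡ᵇ j) ⟧ μ M F G) ∎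
        where open ≡-Reasoning

-- The linear coefficient of the inverse Kazhdan–Lusztig polynomial

i+i≤1+j⇒i≤j : ∀ i j → i ℕ.+ i ≤ suc j → i ≤ j
i+i≤1+j⇒i≤j zero j _ = z≤n
i+i≤1+j⇒i≤j (suc i) j (s≤s i+1+i≤1+j) = ℕP.≤-trans (ℕP.m≤n+m (suc i) i) i+1+i≤1+j

module InverseKL {n : ℕ} (M : Matroid n) (q : Subset n → Subset n → Poly) (kl : IsInverseKL M q) where
  open Matroid M
  open MatroidProperties M
  open Möbius M
  open WhitneyNumbers M
  open IsInverseKL kl

  q-rank0 : ∀ {H} → Flat H → rank H ≡ 0 → q (0̂ M) H 0 ≡ 1ℤ × (∀ k → q (0̂ M) H (suc k) ≡ 0ℤ)
  q-rank0 fH rH≡0 = rank-zero (0̂ M) _ Flat-0̂ fH (0̂⊆ fH) (trans rH≡0 (sym rank-0̂))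

  q-vanishes : ∀ {H} → Flat H → 1 ≤ rank H → ∀ k → rank H ≤ 2 ℕ.* k → q (0̂ M) H k ≡ 0ℤ
  q-vanishes {H} fH 1≤rH k rH≤2k = degree (0̂ M) H Flat-0̂ fH (0̂⊆ fH)
    (subst (λ r₀ → suc r₀ ≤ rank H) (sym rank-0̂) 1≤rH) k (subst (λ r₀ → rank H ∸ r₀ ≤ 2 ℕ.* k) (sym rank-0̂) rH≤2k)

  rank1-recursion-term : ∀ {H X} → rank H ≡ 1 → X ∈ᵇ[ 0̂ M , H ] ≡ true →
    (sgn (rank X ∸ rank (0̂ M)) ·ₚ (q (0̂ M) X *ₚ rev (rank H ∸ rank X) (χ M X H))) 1 ≡ ⟦ rank X ≡ᵇ 0 ⟧ χ M X H 0
  rank1-recursion-term {H} {X} rH≡1 X∈ with ∈ᵇ[]⇒ {0̂ M} {H} {X} X∈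
  ... | fX , _ , X⊆H = subst₂ (λ r₀ r → term-with r₀ r (rank X)) (sym rank-0̂) (sym rH≡1) (by-rank (rank X) refl)
    where
      term-with : ℕ → ℕ → ℕ → Set
      term-with r₀ r j = (sgn (j ∸ r₀) ·ₚ (q (0̂ M) X *ₚ rev (r ∸ j) (χ M X H))) 1 ≡ ⟦ j ≡ᵇ 0 ⟧ χ M X H 0
      by-rank : ∀ j → rank X ≡ j → term-with 0 1 j
      by-rank zero rX = trans (ℤP.*-identityˡ _)
        (trans (*ₚ-constantˡ (q (0̂ M) X) (rev 1 (χ M X H)) 1 1ℤ (proj₁ (q-rank0 fX rX)) (proj₂ (q-rank0 fX rX)))
               (ℤP.*-identityˡ _))
      by-rank (suc zero) rX =
        trans (cong (sgn 1 *_) (*ₚ-coeff-zero (q (0̂ M) X) (rev 0 (χ M X H)) 1 vanish)) (ℤP.*-zeroʳ (sgn 1))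
        where
          vanish : ∀ i → i ≤ 1 → q (0̂ M) X i * rev 0 (χ M X H) (1 ∸ i) ≡ 0ℤ
          vanish zero _ = ℤP.*-zeroʳ (q (0̂ M) X 0)
          vanish (suc i) _ = cong (_* rev 0 (χ M X H) (1 ∸ suc i))
            (q-vanishes fX (ℕP.≤-reflexive (sym rX)) (suc i) (subst (_≤ 2 ℕ.* suc i) (sym rX) (s≤s z≤n)))
      by-rank (suc (suc _)) rX = ⊥-elim (ℕP.<⇒≱ (s≤s (s≤s z≤n)) (subst₂ _≤_ rX rH≡1 (rank-⊆ X⊆H)))

  q-rank1 : ∀ {H} → Flat H → rank H ≡ 1 → q (0̂ M) H 0 ≡ 1ℤ
  q-rank1 {H} fH rH≡1 = ℤP.neg-injective (begin
      - q (0̂ M) H 0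
    ≡⟨ sym (ℤP.-1*i≡-i (q (0̂ M) H 0)) ⟩
      (sgn 1 ·ₚ rev 1 (q (0̂ M) H)) 1
    ≡⟨ cong (λ d → (sgn d ·ₚ rev d (q (0̂ M) H)) 1) (sym rH∸r0̂) ⟩
      (sgn (rank H ∸ rank (0̂ M)) ·ₚ rev (rank H ∸ rank (0̂ M)) (q (0̂ M) H)) 1
    ≡⟨ recursion (0̂ M) H Flat-0̂ fH (0̂⊆ fH) 1 ⟩
      Σ[ interval M (0̂ M) H ] term
    ≡⟨ Σ-interval (0̂ M) H term ⟩
      Σₛ (λ X → ⟦ X ∈ᵇ[ 0̂ M , H ] ⟧ term X)
    ≡⟨ Σₛ-⟦⟧-cong (_∈ᵇ[ 0̂ M , H ]) term _ (λ X → rank1-recursion-term rH≡1) ⟩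
      Σₛ (λ X → ⟦ X ∈ᵇ[ 0̂ M , H ] ⟧ ⟦ rank X ≡ᵇ 0 ⟧ χ M X H 0)
    ≡⟨ Σ-rank0 fH (λ X → χ M X H 0) ⟩
      χ M (0̂ M) H 0
    ≡⟨ χ-constant fH (0̂⊆ fH) ⟩
      μ M (0̂ M) H
    ≡⟨ μ-atom fH rH≡1 ⟩
      - 1ℤ ∎)
    where
      open ≡-Reasoning
      rH∸r0̂ : rank H ∸ rank (0̂ M) ≡ 1
      rH∸r0̂ rewrite rH≡1 | rank-0̂ = refl
      term : Subset n → ℤ
      term X = (sgn (rank X ∸ rank (0̂ M)) ·ₚ (q (0̂ M) X *ₚ rev (rank H ∸ rank X) (χ M X H))) 1

  -- Either 2i ≥ rank H, so q i = 0 by the degree bound, or K ∸ i exceeds the degree K ∸ (rank H ∸ 1) of the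
  -- reversed polynomial.
  q*rev-coeff-zero : ∀ {H K j} {p : Poly} → Flat H → rank H ≡ suc (suc j) → suc j ≤ K →
                     (q (0̂ M) H *ₚ rev (K ∸ suc j) p) K ≡ 0ℤ
  q*rev-coeff-zero {H} {K} {j} {p} fH rH 1+j≤K = *ₚ-coeff-zero (q (0̂ M) H) (rev (K ∸ suc j) p) K vanish
    where
      vanish : ∀ i → i ≤ K → q (0̂ M) H i * rev (K ∸ suc j) p (K ∸ i) ≡ 0ℤ
      vanish i i≤K with suc (suc j) ℕP.≤? 2 ℕ.* i
      ... | yes 2+j≤2i = cong (_* rev (K ∸ suc j) p (K ∸ i))
              (q-vanishes fH (subst (1 ≤_) (sym rH) (s≤s z≤n)) i (subst (_≤ 2 ℕ.* i) (sym rH) 2+j≤2i))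
      ... | no 2+j≰2i = trans (cong (q (0̂ M) H i *_) (rev-vanishes (K ∸ suc j) p (K ∸ i) K∸1+j<K∸i))
                              (ℤP.*-zeroʳ (q (0̂ M) H i))
        where
          i≤j : i ≤ j
          i≤j = i+i≤1+j⇒i≤j i j (subst (_≤ suc j) (cong (i ℕ.+_) (ℕP.+-identityʳ i)) (ℕP.≤-pred (ℕP.≰⇒> 2+j≰2i)))
          K∸1+j<K∸i : K ∸ suc j < K ∸ i
          K∸1+j<K∸i = ℕP.∸-monoʳ-< (s≤s i≤j) 1+j≤K

  recursion-term : ∀ K → rank ⊤ ≡ suc K → ∀ {H} → Flat H →
    (sgn (rank H ∸ rank (0̂ M)) ·ₚ (q (0̂ M) H *ₚ rev (rank ⊤ ∸ rank H) (χ M H ⊤))) K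
      ≡ ⟦ rank H ≡ᵇ 0 ⟧ χ M H ⊤ 1 + ⟦ rank H ≡ᵇ 1 ⟧ (- χ M H ⊤ 0)
  recursion-term K r≡1+K {H} fH = subst₂ (λ r₀ r → term-with r₀ r (rank H)) (sym rank-0̂) (sym r≡1+K) (by-rank (rank H) refl)
    where
      term-with : ℕ → ℕ → ℕ → Set
      term-with r₀ r j = (sgn (j ∸ r₀) ·ₚ (q (0̂ M) H *ₚ rev (r ∸ j) (χ M H ⊤))) K
                         ≡ ⟦ j ≡ᵇ 0 ⟧ χ M H ⊤ 1 + ⟦ j ≡ᵇ 1 ⟧ (- χ M H ⊤ 0)
      by-rank : ∀ j → rank H ≡ j → term-with 0 (suc K) j
      by-rank zero rH = begin
          1ℤ * (q (0̂ M) H *ₚ rev (suc K) (χ M H ⊤)) K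
        ≡⟨ ℤP.*-identityˡ _ ⟩
          (q (0̂ M) H *ₚ rev (suc K) (χ M H ⊤)) K
        ≡⟨ *ₚ-constantˡ (q (0̂ M) H) (rev (suc K) (χ M H ⊤)) K 1ℤ (proj₁ (q-rank0 fH rH)) (proj₂ (q-rank0 fH rH)) ⟩
          1ℤ * rev (suc K) (χ M H ⊤) K
        ≡⟨ trans (ℤP.*-identityˡ _) (rev-1+k-k (χ M H ⊤) K) ⟩
          χ M H ⊤ 1
        ≡⟨ sym (ℤP.+-identityʳ _) ⟩
          χ M H ⊤ 1 + 0ℤ ∎
        where open ≡-Reasoning
      by-rank (suc zero) rH = begin
          sgn 1 * (q (0̂ M) H *ₚ rev K (χ M H ⊤)) K
        ≡⟨ cong (sgn 1 *_) (*ₚ-constantˡ (q (0̂ M) H) (rev K (χ M H ⊤)) K 1ℤ (q-rank1 fH rH) q+≡0) ⟩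
          sgn 1 * (1ℤ * rev K (χ M H ⊤) K)
        ≡⟨ cong (λ v → sgn 1 * v) (trans (ℤP.*-identityˡ _) (rev-k-k (χ M H ⊤) K)) ⟩
          sgn 1 * χ M H ⊤ 0
        ≡⟨ trans (ℤP.-1*i≡-i _) (sym (ℤP.+-identityˡ _)) ⟩
          0ℤ + - χ M H ⊤ 0 ∎
        where
          open ≡-Reasoning
          q+≡0 : ∀ i → q (0̂ M) H (suc i) ≡ 0ℤ
          q+≡0 i = q-vanishes fH (ℕP.≤-reflexive (sym rH)) (suc i) (subst (_≤ 2 ℕ.* suc i) (sym rH) (s≤s z≤n))
      by-rank (suc (suc j)) rH =
        trans (cong (sgn (suc (suc j)) *_) (q*rev-coeff-zero {p = χ M H ⊤} fH rH 1+j≤K)) (ℤP.*-zeroʳ (sgn (suc (suc j))))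
        where 1+j≤K : suc j ≤ K
              1+j≤K = ℕP.≤-pred (subst₂ _≤_ rH r≡1+K (rank≤rank⊤ H))

  sgn*q₁ : ∀ K → rank ⊤ ≡ suc K → sgn (suc K) * q (0̂ M) ⊤ 1 ≡ w M (+ 0) (+ K) - w M (+ 1) (+ suc K)
  sgn*q₁ K r≡1+K = begin
      sgn (suc K) * q (0̂ M) ⊤ 1
    ≡⟨ reversed ⟩
      (sgn (rank ⊤ ∸ rank (0̂ M)) ·ₚ rev (rank ⊤ ∸ rank (0̂ M)) (q (0̂ M) ⊤)) K
    ≡⟨ recursion (0̂ M) ⊤ Flat-0̂ Flat-⊤ (0̂⊆ Flat-⊤) K ⟩
      Σ[ interval M (0̂ M) ⊤ ] term
    ≡⟨ Σ-interval (0̂ M) ⊤ term ⟩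
      Σₛ (λ H → ⟦ H ∈ᵇ[ 0̂ M , ⊤ ] ⟧ term H)
    ≡⟨ Σₛ-⟦⟧-cong (_∈ᵇ[ 0̂ M , ⊤ ]) term _ (λ H H∈ → recursion-term K r≡1+K (proj₁ (∈ᵇ[]⇒ {0̂ M} {⊤} {H} H∈))) ⟩
      Σₛ (λ H → ⟦ H ∈ᵇ[ 0̂ M , ⊤ ] ⟧ (⟦ rank H ≡ᵇ 0 ⟧ χ M H ⊤ 1 + ⟦ rank H ≡ᵇ 1 ⟧ (- χ M H ⊤ 0)))
    ≡⟨ Σ-cong (allSubsets n) (λ H → ⟦⟧-+ (H ∈ᵇ[ 0̂ M , ⊤ ]) (⟦ rank H ≡ᵇ 0 ⟧ χ M H ⊤ 1) (⟦ rank H ≡ᵇ 1 ⟧ (- χ M H ⊤ 0))) ⟩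
      Σₛ (λ H → ⟦ H ∈ᵇ[ 0̂ M , ⊤ ] ⟧ ⟦ rank H ≡ᵇ 0 ⟧ χ M H ⊤ 1 + ⟦ H ∈ᵇ[ 0̂ M , ⊤ ] ⟧ ⟦ rank H ≡ᵇ 1 ⟧ (- χ M H ⊤ 0))
    ≡⟨ Σ-+ (allSubsets n) (λ H → ⟦ H ∈ᵇ[ 0̂ M , ⊤ ] ⟧ ⟦ rank H ≡ᵇ 0 ⟧ χ M H ⊤ 1)
                          (λ H → ⟦ H ∈ᵇ[ 0̂ M , ⊤ ] ⟧ ⟦ rank H ≡ᵇ 1 ⟧ (- χ M H ⊤ 0)) ⟩
      Σₛ (λ H → ⟦ H ∈ᵇ[ 0̂ M , ⊤ ] ⟧ ⟦ rank H ≡ᵇ 0 ⟧ χ M H ⊤ 1)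
        + Σₛ (λ H → ⟦ H ∈ᵇ[ 0̂ M , ⊤ ] ⟧ ⟦ rank H ≡ᵇ 1 ⟧ (- χ M H ⊤ 0))
    ≡⟨ cong₂ _+_ (Σχ≡w′ 0 K 1 (ℕP.n≤1+n K) r∸K≡1)
                 (trans (Σ-cong (allSubsets n) pull-neg)
                 (trans (Σ-neg (allSubsets n) (λ H → ⟦ H ∈ᵇ[ 0̂ M , ⊤ ] ⟧ ⟦ rank H ≡ᵇ 1 ⟧ χ M H ⊤ 0))
                        (cong -_ (Σχ≡w′ 1 (suc K) 0 ℕP.≤-refl r∸1+K≡0)))) ⟩
      w M (+ 0) (+ K) - w M (+ 1) (+ suc K) ∎
    where
      open ≡-Reasoning
      term : Subset n → ℤ
      term H = (sgn (rank H ∸ rank (0̂ M)) ·ₚ (q (0̂ M) H *ₚ rev (rank ⊤ ∸ rank H) (χ M H ⊤))) K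
      reversed : sgn (suc K) * q (0̂ M) ⊤ 1 ≡ (sgn (rank ⊤ ∸ rank (0̂ M)) ·ₚ rev (rank ⊤ ∸ rank (0̂ M)) (q (0̂ M) ⊤)) K
      reversed rewrite rank-0̂ | r≡1+K = cong (sgn (suc K) *_) (sym (rev-1+k-k (q (0̂ M) ⊤) K))
      r∸K≡1 : rank ⊤ ∸ K ≡ 1
      r∸K≡1 = trans (cong (_∸ K) r≡1+K) (ℕP.m+n∸n≡m 1 K)
      r∸1+K≡0 : rank ⊤ ∸ suc K ≡ 0
      r∸1+K≡0 = trans (cong (_∸ suc K) r≡1+K) (ℕP.n∸n≡0 (suc K))
      Σχ≡w′ : ∀ i j k → j ≤ suc K → rank ⊤ ∸ j ≡ k →
              Σₛ (λ F → ⟦ F ∈ᵇ[ 0̂ M , ⊤ ] ⟧ ⟦ rank F ≡ᵇ i ⟧ χ M F ⊤ k) ≡ w M (+ i) (+ j)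
      Σχ≡w′ i j k j≤1+K refl = Σχ≡w i j (subst (j ≤_) (sym r≡1+K) j≤1+K)
      pull-neg : ∀ H → ⟦ H ∈ᵇ[ 0̂ M , ⊤ ] ⟧ ⟦ rank H ≡ᵇ 1 ⟧ (- χ M H ⊤ 0) ≡ - ⟦ H ∈ᵇ[ 0̂ M , ⊤ ] ⟧ ⟦ rank H ≡ᵇ 1 ⟧ χ M H ⊤ 0
      pull-neg H = trans (cong (⟦ H ∈ᵇ[ 0̂ M , ⊤ ] ⟧_) (⟦⟧-neg (rank H ≡ᵇ 1) (χ M H ⊤ 0)))
                         (⟦⟧-neg (H ∈ᵇ[ 0̂ M , ⊤ ]) (⟦ rank H ≡ᵇ 1 ⟧ χ M H ⊤ 0))

  q₁-rank-suc : ∀ K → rank ⊤ ≡ suc K → q (0̂ M) ⊤ 1 ≡ + ∣ w M (+ 1) (+ suc K) ∣ - + ∣ w M (+ 0) (+ K) ∣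
  q₁-rank-suc K r≡1+K = begin
      q₁
    ≡⟨ sym (trans (cong (_* q₁) (sgn*sgn≡1 K)) (ℤP.*-identityˡ q₁)) ⟩
      sgn K * sgn K * q₁
    ≡⟨ regroup (sgn K) q₁ ⟩
      sgn K * - (sgn (suc K) * q₁)
    ≡⟨ cong (λ v → sgn K * - v) (sgn*q₁ K r≡1+K) ⟩
      sgn K * - (w₀ - w₁)
    ≡⟨ distribute (sgn K) w₀ w₁ ⟩
      sgn K * w₁ - sgn K * w₀
    ≡⟨ sym (cong₂ _-_ (0≤sgn*x⇒+∣x∣≡sgn*x K w₁ (sgn*w≥0 1 (suc K))) (0≤sgn*x⇒+∣x∣≡sgn*x K w₀ (sgn*w≥0 0 K))) ⟩
      + ∣ w₁ ∣ - + ∣ w₀ ∣ ∎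
    where
      open ≡-Reasoning
      q₁ = q (0̂ M) ⊤ 1
      w₀ = w M (+ 0) (+ K)
      w₁ = w M (+ 1) (+ suc K)
      regroup : ∀ s x → s * s * x ≡ s * - ((- s) * x)
      regroup = solve-∀
      distribute : ∀ s a b → s * - (a - b) ≡ s * b - s * a
      distribute = solve-∀

  q₁-rank-zero : rank ⊤ ≡ 0 → q (0̂ M) ⊤ 1 ≡ + ∣ w M (+ 1) (+ 0) ∣ - + ∣ w M (+ 0) (+ 0 - + 1) ∣
  q₁-rank-zero r≡0 = trans (proj₂ (q-rank0 Flat-⊤ r≡0) 0) (sym (cong₂ (λ a b → + ∣ a ∣ - + ∣ b ∣) w₁≡0 w₀≡0))
    where
      rank≡0 : ∀ F → rank F ≡ 0
      rank≡0 F = ℕP.n≤0⇒n≡0 (subst (rank F ≤_) r≡0 (rank≤rank⊤ F))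
      w₁≡0 : w M (+ 1) (+ 0) ≡ 0ℤ
      w₁≡0 = Σ-zero (flats M) λ F → Σ-zero (flats M) λ G →
               cong (λ b → ⟦ b ∧ (rank G ≡ᵇ 0) ⟧ μ M F G) (cong (_≡ᵇ 1) (rank≡0 F))
      w₀≡0 : w M (+ 0) (+ 0 - + 1) ≡ 0ℤ
      w₀≡0 = Σ-zero (flats M) λ F → Σ-zero (flats M) λ G →
               cong (⟦_⟧ μ M F G) (BoolP.∧-zeroʳ (rank F ≡ᵇ 0))

theorem3p3 : ∀ {n : ℕ} (M : Matroid n) (q : Subset n → Subset n → Poly) →
    IsInverseKL M q →
    q (0̂ M) ⊤ 1 ≡ + ∣ w M (+ 1) (+ r M) ∣ - + ∣ w M (+ 0) (+ r M - + 1) ∣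
theorem3p3 M q kl = by-rank (r M) refl
  where
    open InverseKL M q kl
    by-rank : ∀ R → r M ≡ R → q (0̂ M) ⊤ 1 ≡ + ∣ w M (+ 1) (+ R) ∣ - + ∣ w M (+ 0) (+ R - + 1) ∣
    by-rank zero = q₁-rank-zero
    by-rank (suc K) = q₁-rank-suc K
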